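{- Let $d\ge 3$, $\mathcal A=\{0,1,\dots,d-1\}$, let $\varphi_d$ be the morphism $\varphi_d(i)=0(i+1)$ for $0\le i\le d-2$, $\varphi_d(d-1)=0(d-1)(d-1)$, and let $\mathbf u_d$ be its fixed point. Then every bispecial factor of $\mathbf u_d$ is ordinary.
   Context: The fixed point $\mathbf u_d$ is the unique infinite word starting with $0$ with $\varphi_d(\mathbf u_d)=\mathbf u_d$; $\mathcal L(\mathbf u_d)$ denotes its set of finite factors. For a factor $w$, $\mathrm{Lext}(w)=\{iw\in\mathcal L(\mathbf u_d): i\in\mathcal A\}$, $\mathrm{Rext}(w)=\{wi\in\mathcal L(\mathbf u_d): i\in\mathcal A\}$, $\mathrm{Bext}(w)=\{iwj\in\mathcal L(\mathbf u_d): i,j\in\mathcal A\}$. The factor $w$ is left (right) special if $\#\mathrm{Lext}(w)\ge 2$ ($\#\mathrm{Rext}(w)\ge2$), and bispecial if it is both. The bilateral order is $\mathrm b(w)=\#\mathrm{Bext}(w)-\#\mathrm{Lext}(w)-\#\mathrm{Rext}(w)+1$, and a bispecial factor is ordinary if $\mathrm b(w)=0$. -}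

module Defs where

open import Data.Nat using (ℕ; zero; suc; _+_; _<_; _≤_; s≤s)
open import Data.Nat.Properties using (_<?_)
open import Data.Fin using (Fin; toℕ; fromℕ<)
open import Data.List using (List; []; _∷_; _++_; concatMap; map; upTo; length)
open import Data.List.Membership.Propositional using (_∈_)
open import Data.List.Relation.Unary.Unique.Propositional using (Unique)
open import Data.Product using (_×_; ∃-syntax; _,_)
open import Data.Integer as ℤ using (ℤ; +_; _-_)
open import Relation.Binary.PropositionalEquality using (_≡_)
open import Relation.Nullary using (yes; no)
open import Function.Bundles using (_⇔_)

-- Throughout, the alphabet is A = {0,…,d-1} = Fin d with d = suc n.

φ-letter : (n : ℕ) → Fin (suc n) → List (Fin (suc n))
φ-letter n i with toℕ i <? n
... | yes p = Fin.zero ∷ fromℕ< {suc (toℕ i)} {suc n} (s≤s p) ∷ []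
... | no _  = Fin.zero ∷ i ∷ i ∷ []

φ : (n : ℕ) → List (Fin (suc n)) → List (Fin (suc n))
φ n = concatMap (φ-letter n)

φ^ : (n : ℕ) → ℕ → List (Fin (suc n)) → List (Fin (suc n))
φ^ n zero    w = w
φ^ n (suc k) w = φ n (φ^ n k w)

nth : {A : Set} → List A → ℕ → A → A
nth []       _       a = a
nth (x ∷ _)  zero    _ = x
nth (_ ∷ xs) (suc k) a = nth xs k a

-- Since φ^k(0) is a prefix of φ^(k+1)(0) and |φ^(m+1)(0)| ≥ m+1, the default
-- value is never used and this is the unique fixed point starting with 0.
u : (n : ℕ) → ℕ → Fin (suc n)
u n m = nth (φ^ n (suc m) (Fin.zero ∷ [])) m Fin.zero

window : (n : ℕ) → ℕ → ℕ → List (Fin (suc n))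
window n m k = map (λ j → u n (m + j)) (upTo k)

Factor : (n : ℕ) → List (Fin (suc n)) → Set
Factor n w = ∃[ m ] window n m (length w) ≡ w

InLext : (n : ℕ) → List (Fin (suc n)) → Fin (suc n) → Set
InLext n w i = Factor n (i ∷ w)

InRext : (n : ℕ) → List (Fin (suc n)) → Fin (suc n) → Set
InRext n w j = Factor n (w ++ j ∷ [])

InBext : (n : ℕ) → List (Fin (suc n)) → Fin (suc n) × Fin (suc n) → Set
InBext n w (i , j) = Factor n (i ∷ w ++ j ∷ [])

-- xs is a duplicate-free enumeration of the set {x | P x}; then #{x | P x} = length xs.
Enumerates : {A : Set} → (A → Set) → List A → Set
Enumerates {A} P xs = Unique xs × (∀ (x : A) → (x ∈ xs) ⇔ P x)

bilateralOrder : (nB nL nR : ℕ) → ℤ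
bilateralOrder nB nL nR = ((+ nB) - (+ nL)) - (+ nR) ℤ.+ (+ 1)

module Submission where

-- Since 𝐮 = φ(𝐮), 𝐮 is a concatenation of blocks φ(a) = 0 σ(a) (a < top) and φ(top) = 0 top top, so its
-- zeros are exactly the block starts and two adjacent nonzero letters only occur inside 0 top top 0. Hence a
-- bispecial factor other than ε and top has the form [top] φ(v) 0 [top] for a shorter bispecial factor v, and
-- its extension pairs (x, y) are the images of the extension pairs (a, b) of v under letter maps fixed by the
-- optional tops: a ↦ σ a without a top, and a ↦ (0 if a < top, top if a = top) for the a with σ a = top.
-- Starting from the extensions {(k, y), (x, k) : x, y > k} ∪ {(top, top)} of ε (with k = 0), such images stay
-- among these "fans" and the "corners" {(x, y), (x, y′), (x′, y)}, and both satisfy #B = #L + #R - 1.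

open import Data.Bool using (Bool; true; false)
open import Data.Fin using (Fin; toℕ; fromℕ; fromℕ<) renaming (zero to 0F; suc to sucF)
open import Data.Fin.Properties using (toℕ-injective; toℕ<n; toℕ-fromℕ; toℕ-fromℕ<) renaming (_≟_ to _≟ᶠ_)
import Data.Integer as ℤ
import Data.Integer.Properties as ℤ
open import Data.Integer.Solver using () renaming (module +-*-Solver to ℤ-Solver)
open import Data.List using (List; []; _∷_; _++_; _∷ʳ_; length; concat; map; applyUpTo; filter; allFin; initLast; _∷ʳ′_)
open import Data.List.Membership.Propositional using (_∈_; _∉_)
open import Data.List.Membership.Propositional.Properties
  using (∈-filter⁺; ∈-filter⁻; ∈-allFin; ∈-map⁺; ∈-map⁻; ∈-++⁺ˡ; ∈-++⁺ʳ; ∈-++⁻)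
open import Data.List.Membership.Propositional.Properties.WithK using (unique∧set⇒bag)
open import Data.List.Properties
  using (length-++; length-map; ++-assoc; ++-identityʳ; map-++; concat-++; map-upTo; ∷-injectiveˡ; ∷-injectiveʳ)
open import Data.List.Relation.Binary.BagAndSetEquality using (∼bag⇒↭)
open import Data.List.Relation.Binary.Permutation.Propositional.Properties using (↭-length)
open import Data.List.Relation.Unary.All using ([]; _∷_)
open import Data.List.Relation.Unary.AllPairs using ([]; _∷_)
open import Data.List.Relation.Unary.Any using (here; there)
open import Data.List.Relation.Unary.Unique.Propositional using (Unique)
import Data.List.Relation.Unary.Unique.Propositional.Properties as Unique
open import Data.Nat using (ℕ; zero; suc; _+_; _*_; _∸_; _≤_; _<_; z≤n; s≤s; s≤s⁻¹)
open import Data.Nat.Properties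
open import Data.Nat.Solver using () renaming (module +-*-Solver to ℕ-Solver)
open import Data.Product using (_×_; _,_; ∃-syntax; proj₁; proj₂; map₂)
open import Data.Sum using (_⊎_; inj₁; inj₂)
open import Data.Unit using (⊤; tt)
open import Function.Base using (_∘_)
open import Function.Bundles using (_⇔_; mk⇔; Equivalence)
open import Level using (0ℓ)
open import Relation.Binary.PropositionalEquality
open import Relation.Nullary using (yes; no; ¬_; contradiction)
open import Relation.Unary using (Pred; _⊆_; _≐_)
open import Relation.Unary.Properties using (≐-trans; ≐-sym)

open import Defs

two-distinct : {X : Set} {xs : List X} → 2 ≤ length xs → Unique xs → ∃[ a ] ∃[ b ] (a ∈ xs × b ∈ xs × a ≢ b)
two-distinct {xs = a ∷ b ∷ _} (s≤s (s≤s _)) ((a≢b ∷ _) ∷ _) = a , b , here refl , there (here refl) , a≢b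

Enumerates-length : {X : Set} {P Q : Pred X 0ℓ} {xs ys : List X} → (∀ x → P x ⇔ Q x)
  → Enumerates P xs → Enumerates Q ys → length xs ≡ length ys
Enumerates-length {xs = xs} {ys} P⇔Q (xs-unique , ∈xs⇔) (ys-unique , ∈ys⇔) =
  ↭-length (∼bag⇒↭ (unique∧set⇒bag xs-unique ys-unique same-elements))
  where
  same-elements : ∀ {x} → x ∈ xs ⇔ x ∈ ys
  same-elements {x} = mk⇔ (λ x∈xs → Equivalence.from (∈ys⇔ x) (Equivalence.to (P⇔Q x) (Equivalence.to (∈xs⇔ x) x∈xs)))
                          (λ x∈ys → Equivalence.from (∈xs⇔ x) (Equivalence.from (P⇔Q x) (Equivalence.to (∈ys⇔ x) x∈ys)))

bilateralOrder-ordinary : (b l r : ℕ) → b + 1 ≡ l + r → bilateralOrder b l r ≡ ℤ.+ 0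
bilateralOrder-ordinary b l r b+1≡l+r = begin
  ℤ.+ b ℤ.- ℤ.+ l ℤ.- ℤ.+ r ℤ.+ ℤ.+ 1          ≡⟨ solve 3 (λ b l r → b :- l :- r :+ con (ℤ.+ 1) := (b :+ con (ℤ.+ 1)) :- (l :+ r))
                                                         refl (ℤ.+ b) (ℤ.+ l) (ℤ.+ r) ⟩
  ℤ.+ (b + 1) ℤ.- (ℤ.+ l ℤ.+ ℤ.+ r)            ≡⟨ cong (λ m → ℤ.+ m ℤ.- (ℤ.+ l ℤ.+ ℤ.+ r)) b+1≡l+r ⟩
  ℤ.+ (l + r) ℤ.- (ℤ.+ l ℤ.+ ℤ.+ r)            ≡⟨ ℤ.+-inverseʳ (ℤ.+ l ℤ.+ ℤ.+ r) ⟩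
  ℤ.+ 0                                        ∎
  where
  open ≡-Reasoning
  open ℤ-Solver using (solve; _:+_; _:-_; _:=_; con)

module Morphism (n : ℕ) where

  A : Set
  A = Fin (suc n)

  top : A
  top = fromℕ n

  toℕ-top : toℕ top ≡ n
  toℕ-top = toℕ-fromℕ n

  toℕ≤n : (a : A) → toℕ a ≤ n
  toℕ≤n a = s≤s⁻¹ (toℕ<n a)

  toℕ≡n⇒≡top : {a : A} → toℕ a ≡ n → a ≡ top
  toℕ≡n⇒≡top e = toℕ-injective (trans e (sym toℕ-top))

  ≡top⇒≮n : {a : A} → a ≡ top → ¬ toℕ a < n
  ≡top⇒≮n refl lt = <⇒≢ lt toℕ-top

  top≢0F : 1 ≤ n → top ≢ 0F
  top≢0F 1≤n e = <⇒≢ 1≤n (sym (trans (sym toℕ-top) (cong toℕ e)))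

  -- φ(i) = 0 σ(i) for i < top, and φ(top) = 0 top top.
  σ : A → A
  σ i with toℕ i <? n
  ... | yes i<n = fromℕ< (s≤s i<n)
  ... | no _    = i

  φ₁ : A → List A
  φ₁ = φ-letter n

  φ₁-below : {i : A} → toℕ i < n → φ₁ i ≡ 0F ∷ σ i ∷ []
  φ₁-below {i} i<n with toℕ i <? n
  ... | yes _   = refl
  ... | no i≮n = contradiction i<n i≮n

  φ₁-notBelow : {i : A} → ¬ toℕ i < n → φ₁ i ≡ 0F ∷ i ∷ i ∷ []
  φ₁-notBelow {i} i≮n with toℕ i <? n
  ... | yes i<n = contradiction i<n i≮n
  ... | no _    = refl

  toℕ-σ : {a : A} → toℕ a < n → toℕ (σ a) ≡ suc (toℕ a)
  toℕ-σ {a} a<n with toℕ a <? n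
  ... | yes _   = toℕ-fromℕ< (s≤s a<n)
  ... | no a≮n = contradiction a<n a≮n

  σ-notBelow : {a : A} → ¬ toℕ a < n → σ a ≡ a
  σ-notBelow {a} a≮n with toℕ a <? n
  ... | yes a<n = contradiction a<n a≮n
  ... | no _    = refl

  -- τ a is the letter following σ a in φ(a) 0.
  τ : A → A
  τ a with toℕ a <? n
  ... | yes _ = 0F
  ... | no _  = a

  τ-below : {a : A} → toℕ a < n → τ a ≡ 0F
  τ-below {a} a<n with toℕ a <? n
  ... | yes _   = refl
  ... | no a≮n = contradiction a<n a≮n

  τ-notBelow : {a : A} → ¬ toℕ a < n → τ a ≡ a
  τ-notBelow {a} a≮n with toℕ a <? n
  ... | yes a<n = contradiction a<n a≮n
  ... | no _    = refl

  data LetterImage (i : A) : Set where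
    below : toℕ i < n → φ₁ i ≡ 0F ∷ σ i ∷ [] → toℕ (σ i) ≡ suc (toℕ i) → LetterImage i
    atTop : i ≡ top → φ₁ i ≡ 0F ∷ i ∷ i ∷ [] → σ i ≡ i → LetterImage i

  letterImage : (i : A) → LetterImage i
  letterImage i with toℕ i <? n
  ... | yes i<n = below i<n (φ₁-below i<n) (toℕ-σ i<n)
  ... | no i≮n  = atTop (toℕ≡n⇒≡top (≤∧≮⇒≡ (toℕ≤n i) i≮n)) (φ₁-notBelow i≮n) (σ-notBelow i≮n)

  below-or-top : (a : A) → toℕ a < n ⊎ a ≡ top
  below-or-top a with letterImage a
  ... | below a<n _ _ = inj₁ a<n
  ... | atTop a≡top _ _ = inj₂ a≡top

  σ-top : σ top ≡ top
  σ-top = σ-notBelow (≡top⇒≮n refl)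

  τ-top : τ top ≡ top
  τ-top = τ-notBelow (≡top⇒≮n refl)

  σ≡top : {a : A} → a ≡ top → σ a ≡ top
  σ≡top refl = σ-top

  τ≡top : {a : A} → a ≡ top → τ a ≡ top
  τ≡top refl = τ-top

  σ-saturates : (a : A) → n ≤ suc (toℕ a) → σ a ≡ top
  σ-saturates a n≤ with below-or-top a
  ... | inj₁ a<n = toℕ≡n⇒≡top (trans (toℕ-σ a<n) (≤-antisym a<n n≤))
  ... | inj₂ a≡top = σ≡top a≡top

  σ≢0F : 1 ≤ n → (a : A) → σ a ≢ 0F
  σ≢0F 1≤n a e with letterImage a
  ... | below _ _ t = 0≢1+n (sym (trans (sym t) (cong toℕ e)))
  ... | atTop a≡top _ s = top≢0F 1≤n (trans (sym a≡top) (trans (sym s) e))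

  σ-preimage : (y : A) → 0 < toℕ y → ∃[ b ] (suc (toℕ b) ≡ toℕ y × σ b ≡ y)
  σ-preimage y 0<y = b , 1+b≡y , toℕ-injective (trans (toℕ-σ (subst (_≤ n) (sym 1+b≡y) (toℕ≤n y))) 1+b≡y)
    where
    b : A
    b = fromℕ< (s≤s (≤-trans (m∸n≤m (toℕ y) 1) (toℕ≤n y)))
    1+b≡y : suc (toℕ b) ≡ toℕ y
    1+b≡y = trans (cong suc (toℕ-fromℕ< _)) (m+[n∸m]≡n 0<y)

  σ-preimage-≡ : {x : A} {k : ℕ} → toℕ x ≡ suc k → ∃[ a ] (toℕ a ≡ k × σ a ≡ x)
  σ-preimage-≡ {x} x≡1+k with σ-preimage x (subst (0 <_) (sym x≡1+k) (s≤s z≤n))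
  ... | a , 1+a≡x , σa≡x = a , suc-injective (trans 1+a≡x x≡1+k) , σa≡x

  σ-preimage-> : {y : A} {k : ℕ} → suc k < toℕ y → ∃[ b ] (k < toℕ b × σ b ≡ y)
  σ-preimage-> {y} 1+k<y with σ-preimage y (<-trans (s≤s z≤n) 1+k<y)
  ... | b , 1+b≡y , σb≡y = b , s≤s⁻¹ (subst (_ <_) (sym 1+b≡y) 1+k<y) , σb≡y

  σ-mono : (b : A) {k : ℕ} → k < toℕ b → suc k < n → suc k < toℕ (σ b)
  σ-mono b k<b 1+k<n with below-or-top b
  ... | inj₁ b<n = subst (_ <_) (sym (toℕ-σ b<n)) (s≤s k<b)
  ... | inj₂ b≡top = subst (_ <_) (sym (trans (cong toℕ (σ≡top b≡top)) toℕ-top)) 1+k<n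

  2≤length-φ₁ : (a : A) → 2 ≤ length (φ₁ a)
  2≤length-φ₁ a with letterImage a
  ... | below _ e _ rewrite e = s≤s (s≤s z≤n)
  ... | atTop _ e _ rewrite e = s≤s (s≤s z≤n)

  φ₁-starts-0F : (a : A) → ∃[ t ] φ₁ a ≡ 0F ∷ t
  φ₁-starts-0F a with letterImage a
  ... | below _ e _ = _ , e
  ... | atTop _ e _ = _ , e

  nth-φ₁-1 : (a : A) → nth (φ₁ a) 1 0F ≡ σ a
  nth-φ₁-1 a with letterImage a
  ... | below _ e _ rewrite e = refl
  ... | atTop _ e s rewrite e = sym s

  φ-++ : (xs ys : List A) → φ n (xs ++ ys) ≡ φ n xs ++ φ n ys
  φ-++ xs ys = trans (cong concat (map-++ φ₁ xs ys)) (sym (concat-++ (map φ₁ xs) (map φ₁ ys)))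

  φ-[_] : (a : A) → φ n (a ∷ []) ≡ φ₁ a
  φ-[ a ] = ++-identityʳ (φ₁ a)

  length-φ : (xs : List A) → 2 * length xs ≤ length (φ n xs)
  length-φ [] = z≤n
  length-φ (x ∷ xs) = begin
    2 * suc (length xs)               ≡⟨ *-distribˡ-+ 2 1 (length xs) ⟩
    2 + 2 * length xs                 ≤⟨ +-mono-≤ (2≤length-φ₁ x) (length-φ xs) ⟩
    length (φ₁ x) + length (φ n xs)   ≡⟨ length-++ (φ₁ x) ⟨
    length (φ n (x ∷ xs))             ∎
    where open ≤-Reasoning

module FixedPoint (n : ℕ) where
  open Morphism n

  𝐮 : ℕ → A
  𝐮 = u n

  𝐔 : ℕ → List A
  𝐔 k = φ^ n k (0F ∷ [])

  infix 4 _⊑_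
  _⊑_ : List A → List A → Set
  xs ⊑ ys = ∃[ t ] ys ≡ xs ++ t

  ⊑-refl : {xs : List A} → xs ⊑ xs
  ⊑-refl {xs} = [] , sym (++-identityʳ xs)

  ⊑-trans : {xs ys zs : List A} → xs ⊑ ys → ys ⊑ zs → xs ⊑ zs
  ⊑-trans {xs} (t , refl) (t′ , refl) = t ++ t′ , ++-assoc xs t t′

  φ-⊑ : {xs ys : List A} → xs ⊑ ys → φ n xs ⊑ φ n ys
  φ-⊑ {xs} (t , refl) = φ n t , φ-++ xs t

  nth-++ˡ : (xs ys : List A) {i : ℕ} → i < length xs → nth (xs ++ ys) i 0F ≡ nth xs i 0F
  nth-++ˡ (x ∷ xs) ys {zero} _ = refl
  nth-++ˡ (x ∷ xs) ys {suc i} i<|xs| = nth-++ˡ xs ys (s≤s⁻¹ i<|xs|)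

  nth-⊑ : {xs ys : List A} {i : ℕ} → xs ⊑ ys → i < length xs → nth ys i 0F ≡ nth xs i 0F
  nth-⊑ {xs} (t , refl) = nth-++ˡ xs t

  𝐔-⊑-suc : (k : ℕ) → 𝐔 k ⊑ 𝐔 (suc k)
  𝐔-⊑-suc zero with φ₁-starts-0F 0F
  ... | t , e = t , trans (φ-[ 0F ]) e
  𝐔-⊑-suc (suc k) = φ-⊑ (𝐔-⊑-suc k)

  𝐔-mono : {k K : ℕ} → k ≤ K → 𝐔 k ⊑ 𝐔 K
  𝐔-mono {K = zero} z≤n = ⊑-refl
  𝐔-mono {k} {suc K} k≤1+K with m≤n⇒m<n∨m≡n k≤1+K
  ... | inj₁ k<1+K = ⊑-trans (𝐔-mono (s≤s⁻¹ k<1+K)) (𝐔-⊑-suc K)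
  ... | inj₂ refl = ⊑-refl

  length-𝐔 : (k : ℕ) → k < length (𝐔 k)
  length-𝐔 zero = s≤s z≤n
  length-𝐔 (suc k) = begin-strict
    suc k                 ≤⟨ length-𝐔 k ⟩
    length (𝐔 k)          <⟨ m<n+m (length (𝐔 k)) (<-≤-trans (s≤s z≤n) (length-𝐔 k)) ⟩
    length (𝐔 k) + length (𝐔 k)   ≡⟨ cong (length (𝐔 k) +_) (+-identityʳ (length (𝐔 k))) ⟨
    2 * length (𝐔 k)      ≤⟨ length-φ (𝐔 k) ⟩
    length (𝐔 (suc k))    ∎
    where open ≤-Reasoning

  OccursAt : ℕ → List A → Set
  OccursAt q []      = ⊤
  OccursAt q (x ∷ w) = 𝐮 q ≡ x × OccursAt (suc q) w

  occurs-cong : {p p′ : ℕ} {w : List A} → p ≡ p′ → OccursAt p w → OccursAt p′ w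
  occurs-cong refl o = o

  segment : ℕ → ℕ → List A
  segment m zero    = []
  segment m (suc k) = 𝐮 m ∷ segment (suc m) k

  occurs-segment : (m k : ℕ) → OccursAt m (segment m k)
  occurs-segment m zero    = tt
  occurs-segment m (suc k) = refl , occurs-segment (suc m) k

  length-segment : (m k : ℕ) → length (segment m k) ≡ k
  length-segment m zero    = refl
  length-segment m (suc k) = cong suc (length-segment (suc m) k)

  segment-∷ʳ : (m k : ℕ) → segment m (suc k) ≡ segment m k ++ 𝐮 (m + k) ∷ []
  segment-∷ʳ m zero    = cong (λ i → 𝐮 i ∷ []) (sym (+-identityʳ m))
  segment-∷ʳ m (suc k) =
    cong (𝐮 m ∷_) (trans (segment-∷ʳ (suc m) k) (cong (λ i → segment (suc m) k ++ 𝐮 i ∷ []) (sym (+-suc m k))))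

  window≡segment : (m k : ℕ) → window n m k ≡ segment m k
  window≡segment m k = trans (map-upTo (λ j → 𝐮 (m + j)) k) (applyUpTo-segment m k (λ j → refl))
    where
    applyUpTo-segment : (m k : ℕ) {f : ℕ → A} → (∀ j → f j ≡ 𝐮 (m + j)) → applyUpTo f k ≡ segment m k
    applyUpTo-segment m zero    f≗ = refl
    applyUpTo-segment m (suc k) f≗ =
      cong₂ _∷_ (trans (f≗ 0) (cong 𝐮 (+-identityʳ m)))
                (applyUpTo-segment (suc m) k (λ j → trans (f≗ (suc j)) (cong 𝐮 (+-suc m j))))

  occurs⇒segment : (q : ℕ) (w : List A) → OccursAt q w → segment q (length w) ≡ w
  occurs⇒segment q []      _       = refl
  occurs⇒segment q (x ∷ w) (e , o) = cong₂ _∷_ e (occurs⇒segment (suc q) w o)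

  segment⇒occurs : (q : ℕ) (w : List A) → segment q (length w) ≡ w → OccursAt q w
  segment⇒occurs q []      _ = tt
  segment⇒occurs q (x ∷ w) e = ∷-injectiveˡ e , segment⇒occurs (suc q) w (∷-injectiveʳ e)

  factor⇒occurs : (w : List A) → Factor n w → ∃[ q ] OccursAt q w
  factor⇒occurs w (q , e) = q , segment⇒occurs q w (trans (sym (window≡segment q (length w))) e)

  occurs⇒factor : (q : ℕ) (w : List A) → OccursAt q w → Factor n w
  occurs⇒factor q w o = q , trans (window≡segment q (length w)) (occurs⇒segment q w o)

  occurs-unique : (q : ℕ) {xs ys : List A} → OccursAt q xs → OccursAt q ys → length xs ≡ length ys → xs ≡ ys
  occurs-unique q {xs} {ys} oxs oys |xs|≡|ys| = begin
    xs                       ≡⟨ occurs⇒segment q xs oxs ⟨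
    segment q (length xs)    ≡⟨ cong (segment q) |xs|≡|ys| ⟩
    segment q (length ys)    ≡⟨ occurs⇒segment q ys oys ⟩
    ys                       ∎
    where open ≡-Reasoning

  occurs-++⁻ˡ : (q : ℕ) (xs ys : List A) → OccursAt q (xs ++ ys) → OccursAt q xs
  occurs-++⁻ˡ q []       ys o       = tt
  occurs-++⁻ˡ q (x ∷ xs) ys (e , o) = e , occurs-++⁻ˡ (suc q) xs ys o

  occurs-++⁻ʳ : (q : ℕ) (xs ys : List A) → OccursAt q (xs ++ ys) → OccursAt (q + length xs) ys
  occurs-++⁻ʳ q []       ys o       = occurs-cong (sym (+-identityʳ q)) o
  occurs-++⁻ʳ q (x ∷ xs) ys (_ , o) = occurs-cong (sym (+-suc q (length xs))) (occurs-++⁻ʳ (suc q) xs ys o)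

  occurs-++⁺ : (q : ℕ) (xs ys : List A) → OccursAt q xs → OccursAt (q + length xs) ys → OccursAt q (xs ++ ys)
  occurs-++⁺ q []       ys _        o = occurs-cong (+-identityʳ q) o
  occurs-++⁺ q (x ∷ xs) ys (e , ox) o = e , occurs-++⁺ (suc q) xs ys ox (occurs-cong (+-suc q (length xs)) o)

  occurs-nth : (q : ℕ) (w : List A) {i : ℕ} → OccursAt q w → i < length w → 𝐮 (q + i) ≡ nth w i 0F
  occurs-nth q (x ∷ w) {zero}  (e , _) _ = trans (cong 𝐮 (+-identityʳ q)) e
  occurs-nth q (x ∷ w) {suc i} (_ , o) i<|w| = trans (cong 𝐮 (+-suc q i)) (occurs-nth (suc q) w o (s≤s⁻¹ i<|w|))

  nth⇒occurs : (q : ℕ) (w : List A) → (∀ i → i < length w → 𝐮 (q + i) ≡ nth w i 0F) → OccursAt q w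
  nth⇒occurs q []      _   = tt
  nth⇒occurs q (x ∷ w) at = trans (cong 𝐮 (sym (+-identityʳ q))) (at 0 (s≤s z≤n))
                          , nth⇒occurs (suc q) w (λ i i<|w| → trans (cong 𝐮 (sym (+-suc q i))) (at (suc i) (s≤s i<|w|)))

  occurs-⊑ : (q : ℕ) {xs ys : List A} → OccursAt q xs → OccursAt q ys → length xs ≤ length ys → xs ⊑ ys
  occurs-⊑ q {[]}     {ys}     _ _ _ = ys , refl
  occurs-⊑ q {x ∷ xs} {y ∷ ys} (ex , oxs) (ey , oys) |xs|≤|ys| with occurs-⊑ (suc q) oxs oys (s≤s⁻¹ |xs|≤|ys|)
  ... | t , ys≡xs++t = t , cong₂ _∷_ (trans (sym ey) ex) ys≡xs++t

  occurs-⊑⁻ : (q : ℕ) {xs ys : List A} → xs ⊑ ys → OccursAt q ys → OccursAt q xs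
  occurs-⊑⁻ q {xs} (t , refl) = occurs-++⁻ˡ q xs t

  𝐔-occurs : (K : ℕ) → OccursAt 0 (𝐔 K)
  𝐔-occurs K = nth⇒occurs 0 (𝐔 K) λ i i<|𝐔K| → begin
    nth (𝐔 (suc i)) i 0F        ≡⟨ nth-⊑ (𝐔-mono (m≤n+m (suc i) K)) (<-trans (n<1+n i) (length-𝐔 (suc i))) ⟨
    nth (𝐔 (K + suc i)) i 0F    ≡⟨ nth-⊑ (𝐔-mono (m≤m+n K (suc i))) i<|𝐔K| ⟩
    nth (𝐔 K) i 0F              ∎
    where open ≡-Reasoning

  φ-prefix-occurs : (xs : List A) → OccursAt 0 xs → OccursAt 0 (φ n xs)
  φ-prefix-occurs xs oxs = occurs-⊑⁻ 0 (φ-⊑ xs⊑𝐔) (𝐔-occurs (suc (length xs)))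
    where
    xs⊑𝐔 : xs ⊑ 𝐔 (length xs)
    xs⊑𝐔 = occurs-⊑ 0 oxs (𝐔-occurs (length xs)) (<⇒≤ (length-𝐔 (length xs)))

  -- pos m = |φ(𝐮[0,m))|: the image of the letter 𝐮 m starts at position pos m.
  pos : ℕ → ℕ
  pos zero    = 0
  pos (suc m) = pos m + length (φ₁ (𝐮 m))

  φ-segment-suc : (m : ℕ) → φ n (segment 0 (suc m)) ≡ φ n (segment 0 m) ++ φ₁ (𝐮 m)
  φ-segment-suc m = trans (cong (φ n) (segment-∷ʳ 0 m))
                          (trans (φ-++ (segment 0 m) (𝐮 m ∷ [])) (cong (φ n (segment 0 m) ++_) φ-[ 𝐮 m ]))

  length-φ-segment : (m : ℕ) → length (φ n (segment 0 m)) ≡ pos m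
  length-φ-segment zero    = refl
  length-φ-segment (suc m) = begin
    length (φ n (segment 0 (suc m)))                   ≡⟨ cong length (φ-segment-suc m) ⟩
    length (φ n (segment 0 m) ++ φ₁ (𝐮 m))             ≡⟨ length-++ (φ n (segment 0 m)) ⟩
    length (φ n (segment 0 m)) + length (φ₁ (𝐮 m))     ≡⟨ cong (_+ length (φ₁ (𝐮 m))) (length-φ-segment m) ⟩
    pos (suc m)                                         ∎
    where open ≡-Reasoning

  φ₁-occurs : (m : ℕ) → OccursAt (pos m) (φ₁ (𝐮 m))
  φ₁-occurs m = occurs-cong (length-φ-segment m)
    (occurs-++⁻ʳ 0 (φ n (segment 0 m)) (φ₁ (𝐮 m))
      (subst (OccursAt 0) (φ-segment-suc m) (φ-prefix-occurs _ (occurs-segment 0 (suc m)))))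

  𝐮-pos : (m : ℕ) → 𝐮 (pos m) ≡ 0F
  𝐮-pos m with φ₁-starts-0F (𝐮 m) | φ₁-occurs m
  ... | t , e | o = proj₁ (subst (OccursAt (pos m)) e o)

  𝐮-pos+1 : (m : ℕ) → 𝐮 (suc (pos m)) ≡ σ (𝐮 m)
  𝐮-pos+1 m = trans (cong 𝐮 (+-comm 1 (pos m)))
                    (trans (occurs-nth (pos m) (φ₁ (𝐮 m)) (φ₁-occurs m) (2≤length-φ₁ (𝐮 m))) (nth-φ₁-1 (𝐮 m)))

  pos-suc-below : (m : ℕ) → toℕ (𝐮 m) < n → pos (suc m) ≡ 2 + pos m
  pos-suc-below m lt = trans (cong (λ w → pos m + length w) (φ₁-below lt)) (+-comm (pos m) 2)

  pos-suc-top : (m : ℕ) → 𝐮 m ≡ top → pos (suc m) ≡ 3 + pos m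
  pos-suc-top m e = trans (cong (λ w → pos m + length w) (φ₁-notBelow (≡top⇒≮n e))) (+-comm (pos m) 3)

  𝐮-pos+2 : (m : ℕ) → 𝐮 (2 + pos m) ≡ τ (𝐮 m)
  𝐮-pos+2 m with below-or-top (𝐮 m)
  ... | inj₁ lt = trans (cong 𝐮 (sym (pos-suc-below m lt))) (trans (𝐮-pos (suc m)) (sym (τ-below lt)))
  ... | inj₂ e  = trans (proj₁ (proj₂ (proj₂ (subst (OccursAt (pos m)) (φ₁-notBelow ≮n) (φ₁-occurs m)))))
                        (sym (τ-notBelow ≮n))
    where ≮n = ≡top⇒≮n e

  𝐮-last : (m : ℕ) {q : ℕ} → suc q ≡ pos (suc m) → 𝐮 q ≡ σ (𝐮 m)
  𝐮-last m e with below-or-top (𝐮 m)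
  ... | inj₁ lt = trans (cong 𝐮 (suc-injective (trans e (pos-suc-below m lt)))) (𝐮-pos+1 m)
  ... | inj₂ t  = trans (cong 𝐮 (suc-injective (trans e (pos-suc-top m t))))
                        (trans (𝐮-pos+2 m) (trans (τ≡top t) (sym (σ≡top t))))

  𝐮-last-but-one : (m : ℕ) {q : ℕ} → 2 + q ≡ pos (suc m) → 𝐮 q ≡ τ (𝐮 m)
  𝐮-last-but-one m e with below-or-top (𝐮 m)
  ... | inj₁ lt = trans (cong 𝐮 (suc-injective (suc-injective (trans e (pos-suc-below m lt)))))
                        (trans (𝐮-pos m) (sym (τ-below lt)))
  ... | inj₂ t  = trans (cong 𝐮 (suc-injective (suc-injective (trans e (pos-suc-top m t)))))
                        (trans (𝐮-pos+1 m) (trans (σ≡top t) (sym (τ≡top t))))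

  pos-+-length : (m : ℕ) (v : List A) → OccursAt m v → pos (m + length v) ≡ pos m + length (φ n v)
  pos-+-length m []      _ = trans (cong pos (+-identityʳ m)) (sym (+-identityʳ (pos m)))
  pos-+-length m (_ ∷ v) (refl , o) = begin
    pos (m + suc (length v))                         ≡⟨ cong pos (+-suc m (length v)) ⟩
    pos (suc m + length v)                           ≡⟨ pos-+-length (suc m) v o ⟩
    pos m + length (φ₁ (𝐮 m)) + length (φ n v)       ≡⟨ +-assoc (pos m) _ _ ⟩
    pos m + (length (φ₁ (𝐮 m)) + length (φ n v))     ≡⟨ cong (pos m +_) (length-++ (φ₁ (𝐮 m))) ⟨
    pos m + length (φ n (𝐮 m ∷ v))                   ∎
    where open ≡-Reasoning

  φ-occurs : (m : ℕ) (v : List A) → OccursAt m v → OccursAt (pos m) (φ n v)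
  φ-occurs m []      _          = tt
  φ-occurs m (_ ∷ v) (refl , o) = occurs-++⁺ (pos m) (φ₁ (𝐮 m)) (φ n v) (φ₁-occurs m) (φ-occurs (suc m) v o)

  pos-suc-≥ : (m : ℕ) → 2 + pos m ≤ pos (suc m)
  pos-suc-≥ m = ≤-trans (≤-reflexive (+-comm 2 (pos m))) (+-monoʳ-≤ (pos m) (2≤length-φ₁ (𝐮 m)))

  pos-strictMono : {m m′ : ℕ} → m < m′ → pos m < pos m′
  pos-strictMono {m} {suc m′} m<1+m′ with m≤n⇒m<n∨m≡n (s≤s⁻¹ m<1+m′)
  ... | inj₁ m<m′ = <-trans (pos-strictMono m<m′) (≤-trans (n≤1+n _) (pos-suc-≥ m′))
  ... | inj₂ refl = ≤-trans (n≤1+n _) (pos-suc-≥ m)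

  pos-cancel-≤ : {m m′ : ℕ} → pos m ≤ pos m′ → m ≤ m′
  pos-cancel-≤ le = ≮⇒≥ (λ m′<m → <⇒≱ (pos-strictMono m′<m) le)

  pos-suc-∸ : (m k : ℕ) → k ≤ 2 → k + (pos (suc m) ∸ k) ≡ pos (suc m)
  pos-suc-∸ m k k≤2 = m+[n∸m]≡n (≤-trans k≤2 (≤-trans (m≤m+n 2 (pos m)) (pos-suc-≥ m)))

  𝐔-occurs-later : (j : ℕ) → ∃[ q ] OccursAt (suc q) (𝐔 j)
  𝐔-occurs-later zero = pos 1 ∸ 1 , occurs-cong (sym (pos-suc-∸ 0 1 (s≤s z≤n))) (𝐮-pos 1 , tt)
  𝐔-occurs-later (suc j) with 𝐔-occurs-later j
  ... | q , o = pos (suc q) ∸ 1 , occurs-cong (sym (pos-suc-∸ q 1 (s≤s z≤n))) (φ-occurs (suc q) (𝐔 j) o)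

  occurs-later : (xs : List A) → OccursAt 0 xs → ∃[ q ] OccursAt (suc q) xs
  occurs-later xs oxs with 𝐔-occurs-later (length xs)
  ... | q , o = q , occurs-⊑⁻ (suc q) (occurs-⊑ 0 oxs (𝐔-occurs (length xs)) (<⇒≤ (length-𝐔 (length xs)))) o

  value-occurs : (k : ℕ) → k ≤ n → ∃[ m ] toℕ (𝐮 m) ≡ k
  value-occurs zero    _   = 0 , cong toℕ (𝐮-pos 0)
  value-occurs (suc k) k<n with value-occurs k (<⇒≤ k<n)
  ... | m , e = suc (pos m) , trans (cong toℕ (𝐮-pos+1 m)) (trans (toℕ-σ (subst (_< n) (sym e) k<n)) (cong suc e))

  letter-occurs : (a : A) → ∃[ m ] 𝐮 m ≡ a
  letter-occurs a = map₂ toℕ-injective (value-occurs (toℕ a) (toℕ≤n a))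

  data Position (p : ℕ) : Set where
    first  : (m : ℕ) → p ≡ pos m → Position p
    second : (m : ℕ) → p ≡ suc (pos m) → Position p
    third  : (m : ℕ) → p ≡ 2 + pos m → 𝐮 m ≡ top → Position p

  position : (p : ℕ) → Position p
  position zero = first 0 refl
  position (suc p) with position p
  ... | first m e  = second m (cong suc e)
  ... | third m e t = first (suc m) (trans (cong suc e) (sym (pos-suc-top m t)))
  ... | second m e with below-or-top (𝐮 m)
  ...   | inj₁ lt = first (suc m) (trans (cong suc e) (sym (pos-suc-below m lt)))
  ...   | inj₂ t  = third m (cong suc e) t

module Blocks (n : ℕ) (1≤n : 1 ≤ n) where
  open Morphism n
  open FixedPoint n

  𝐮≡0F⇒pos : (p : ℕ) → 𝐮 p ≡ 0F → ∃[ m ] p ≡ pos m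
  𝐮≡0F⇒pos p 𝐮p≡0F with position p
  ... | first m e   = m , e
  ... | second m e  = contradiction (trans (sym (𝐮-pos+1 m)) (trans (cong 𝐮 (sym e)) 𝐮p≡0F)) (σ≢0F 1≤n (𝐮 m))
  ... | third m e t = contradiction (trans (sym (trans (𝐮-pos+2 m) (τ≡top t))) (trans (cong 𝐮 (sym e)) 𝐮p≡0F)) (top≢0F 1≤n)

  adjacent-nonzero : (q : ℕ) → 𝐮 q ≢ 0F → 𝐮 (suc q) ≢ 0F → ∃[ m ] (q ≡ suc (pos m) × 𝐮 m ≡ top)
  adjacent-nonzero q 𝐮q≢0F 𝐮q+1≢0F with position q
  ... | first m e   = contradiction (trans (cong 𝐮 e) (𝐮-pos m)) 𝐮q≢0F
  ... | third m e t = contradiction (trans (cong 𝐮 (trans (cong suc e) (sym (pos-suc-top m t)))) (𝐮-pos (suc m))) 𝐮q+1≢0F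
  ... | second m e with below-or-top (𝐮 m)
  ...   | inj₁ lt = contradiction (trans (cong 𝐮 (trans (cong suc e) (sym (pos-suc-below m lt)))) (𝐮-pos (suc m))) 𝐮q+1≢0F
  ...   | inj₂ t  = m , e , t

  nonzero-pair⇒top-0F : (q : ℕ) {x c d : A} → OccursAt q (x ∷ c ∷ d ∷ []) → x ≢ 0F → c ≢ 0F → c ≡ top × d ≡ 0F
  nonzero-pair⇒top-0F q (ex , ec , ed , _) x≢0F c≢0F with adjacent-nonzero q (x≢0F ∘ trans (sym ex)) (c≢0F ∘ trans (sym ec))
  ... | m , refl , t = trans (sym ec) (trans (𝐮-pos+2 m) (τ≡top t))
                     , trans (sym ed) (trans (cong 𝐮 (sym (pos-suc-top m t))) (𝐮-pos (suc m)))

  nonzero-pair⇒0F-top : (q : ℕ) {d c y : A} → OccursAt q (d ∷ c ∷ y ∷ []) → c ≢ 0F → y ≢ 0F → d ≡ 0F × c ≡ top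
  nonzero-pair⇒0F-top q (ed , ec , ey , _) c≢0F y≢0F with adjacent-nonzero (suc q) (c≢0F ∘ trans (sym ec)) (y≢0F ∘ trans (sym ey))
  ... | m , refl , t = trans (sym ed) (𝐮-pos m) , trans (sym ec) (trans (𝐮-pos+1 m) (σ≡top t))

  φ-++-0F-occurs : (q : ℕ) (v rest : List A) → OccursAt q (φ n v ++ 0F ∷ rest) → 𝐮 q ≡ 0F
  φ-++-0F-occurs q []      rest o = proj₁ o
  φ-++-0F-occurs q (b ∷ v) rest o with φ₁-starts-0F b
  ... | t , e rewrite e = proj₁ o

  -- If a ≠ 𝐮 m, the shorter of φ(a) and φ(𝐮 m) ends where the longer one 0 top top still has top.
  block-letter : (m : ℕ) (a : A) → OccursAt (pos m) (φ₁ a) → 𝐮 (pos m + length (φ₁ a)) ≡ 0F → 𝐮 m ≡ a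
  block-letter m a o next≡0F with letterImage a | below-or-top (𝐮 m)
  ... | atTop a≡top _ _ | inj₂ 𝐮m≡top = trans 𝐮m≡top (sym a≡top)
  ... | below a<n _ _   | inj₁ 𝐮m<n   = toℕ-injective (suc-injective (begin
        suc (toℕ (𝐮 m))  ≡⟨ toℕ-σ 𝐮m<n ⟨
        toℕ (σ (𝐮 m))     ≡⟨ cong toℕ σ-agrees ⟨
        toℕ (σ a)         ≡⟨ toℕ-σ a<n ⟩
        suc (toℕ a)       ∎))
    where
    open ≡-Reasoning
    σ-agrees : σ a ≡ σ (𝐮 m)
    σ-agrees = begin
      σ a                    ≡⟨ nth-φ₁-1 a ⟨
      nth (φ₁ a) 1 0F        ≡⟨ occurs-nth (pos m) (φ₁ a) o (2≤length-φ₁ a) ⟨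
      𝐮 (pos m + 1)          ≡⟨ cong 𝐮 (+-comm (pos m) 1) ⟩
      𝐮 (suc (pos m))        ≡⟨ 𝐮-pos+1 m ⟩
      σ (𝐮 m)                ∎
  ... | below _ e _     | inj₂ 𝐮m≡top = contradiction (trans (sym 𝐮-next≡top) next≡0F) (top≢0F 1≤n)
    where
    open ≡-Reasoning
    𝐮-next≡top : 𝐮 (pos m + length (φ₁ a)) ≡ top
    𝐮-next≡top = begin
      𝐮 (pos m + length (φ₁ a))   ≡⟨ cong (λ w → 𝐮 (pos m + length w)) e ⟩
      𝐮 (pos m + 2)               ≡⟨ cong 𝐮 (+-comm (pos m) 2) ⟩
      𝐮 (2 + pos m)               ≡⟨ 𝐮-pos+2 m ⟩
      τ (𝐮 m)                     ≡⟨ τ≡top 𝐮m≡top ⟩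
      top                         ∎
  ... | atTop a≡top e _ | inj₁ 𝐮m<n = contradiction (trans (sym 𝐮-next≡top) (𝐮-pos (suc m))) (top≢0F 1≤n)
    where
    𝐮-next≡top : 𝐮 (pos (suc m)) ≡ top
    𝐮-next≡top = trans (cong 𝐮 (pos-suc-below m 𝐮m<n))
                       (trans (proj₁ (proj₂ (proj₂ (subst (OccursAt (pos m)) e o)))) a≡top)

  φ-desubstitute : (m : ℕ) (v rest : List A) → OccursAt (pos m) (φ n v ++ 0F ∷ rest) → OccursAt m v
  φ-desubstitute m []      rest _ = tt
  φ-desubstitute m (a ∷ v) rest o = 𝐮m≡a , φ-desubstitute (suc m) v rest o-next
    where
    o-split : OccursAt (pos m) (φ₁ a ++ (φ n v ++ 0F ∷ rest))
    o-split = subst (OccursAt (pos m)) (++-assoc (φ₁ a) (φ n v) (0F ∷ rest)) o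
    o-rest : OccursAt (pos m + length (φ₁ a)) (φ n v ++ 0F ∷ rest)
    o-rest = occurs-++⁻ʳ (pos m) (φ₁ a) _ o-split
    𝐮m≡a : 𝐮 m ≡ a
    𝐮m≡a = block-letter m a (occurs-++⁻ˡ (pos m) (φ₁ a) _ o-split) (φ-++-0F-occurs _ v rest o-rest)
    o-next : OccursAt (pos (suc m)) (φ n v ++ 0F ∷ rest)
    o-next = occurs-cong (cong (λ b → pos m + length (φ₁ b)) (sym 𝐮m≡a)) o-rest

module Extensions (n : ℕ) (1≤n : 1 ≤ n) where
  open Morphism n
  open FixedPoint n
  open Blocks n 1≤n

  Ext : List A → Pred (A × A) 0ℓ
  Ext w (x , y) = ∃[ q ] OccursAt q (x ∷ w ++ y ∷ [])

  tops : Bool → List A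
  tops false = []
  tops true  = top ∷ []

  -- A bispecial factor other than ε and top is tops bl ++ φ(v) ++ 0 ∷ tops br, and a left
  -- (right) extension a of v then becomes the left (right) extension x of it with Flank bl a x.
  imageWord : Bool → Bool → List A → List A
  imageWord bl br v = tops bl ++ φ n v ++ 0F ∷ tops br

  Flank : Bool → A → A → Set
  Flank false a x = σ a ≡ x
  Flank true  a x = σ a ≡ top × τ a ≡ x

  Flank-functional : (b : Bool) {a x x′ : A} → Flank b a x → Flank b a x′ → x ≡ x′
  Flank-functional false e e′ = trans (sym e) e′
  Flank-functional true (_ , e) (_ , e′) = trans (sym e) e′

  Flank-𝐮 : (b : Bool) (m : ℕ) {a x : A} → 𝐮 m ≡ a → Flank b a x → Flank b (𝐮 m) x
  Flank-𝐮 b m {x = x} 𝐮m≡a = subst (λ c → Flank b c x) (sym 𝐮m≡a)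

  Flank-top : (b : Bool) → Flank b top top
  Flank-top false = σ-top
  Flank-top true  = σ-top , τ-top

  Flank-true-top : {x : A} → Flank true top x → x ≡ top
  Flank-true-top (_ , τ≡x) = trans (sym τ≡x) τ-top

  Flank-true-below : {a x : A} → toℕ a < n → Flank true a x → x ≡ 0F
  Flank-true-below a<n (_ , τ≡x) = trans (sym τ≡x) (τ-below a<n)

  Flank-true-penultimate : {a : A} → suc (toℕ a) ≡ n → Flank true a 0F
  Flank-true-penultimate 1+a≡n = σ-saturates _ (≤-reflexive (sym 1+a≡n)) , τ-below (≤-reflexive 1+a≡n)

  occurs-before-block⇒Flank : (b : Bool) (m : ℕ) {q : ℕ} {x : A}
    → OccursAt q (x ∷ tops b) → suc q + length (tops b) ≡ pos (suc m) → Flank b (𝐮 m) x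
  occurs-before-block⇒Flank false m {q} (e , _) q≡ = trans (sym (𝐮-last m (trans (sym (+-identityʳ (suc q))) q≡))) e
  occurs-before-block⇒Flank true m {q} (e , e′ , _) q≡ =
    trans (sym (𝐮-last m q≡′)) e′ , trans (sym (𝐮-last-but-one m q≡′)) e
    where q≡′ = trans (+-comm 1 (suc q)) q≡

  Flank⇒occurs-before-block : (b : Bool) (m : ℕ) {x : A}
    → Flank b (𝐮 m) x → ∃[ q ] (suc q + length (tops b) ≡ pos (suc m) × OccursAt q (x ∷ tops b))
  Flank⇒occurs-before-block false m e = pos (suc m) ∸ 1 , trans (+-identityʳ _) q≡ , trans (𝐮-last m q≡) e , tt
    where q≡ = pos-suc-∸ m 1 (s≤s z≤n)
  Flank⇒occurs-before-block true m (σ≡top , τ≡x) =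
    q , trans (+-comm (suc q) 1) q≡ , trans (𝐮-last-but-one m q≡) τ≡x , trans (𝐮-last m q≡) σ≡top , tt
    where
    q = pos (suc m) ∸ 2
    q≡ = pos-suc-∸ m 2 ≤-refl

  occurs-at-block⇒Flank : (b : Bool) (m : ℕ) {y : A} → OccursAt (pos m) (0F ∷ tops b ++ y ∷ []) → Flank b (𝐮 m) y
  occurs-at-block⇒Flank false m (_ , e , _)      = trans (sym (𝐮-pos+1 m)) e
  occurs-at-block⇒Flank true  m (_ , e , e′ , _) = trans (sym (𝐮-pos+1 m)) e , trans (sym (𝐮-pos+2 m)) e′

  Flank⇒occurs-at-block : (b : Bool) (m : ℕ) {y : A} → Flank b (𝐮 m) y → OccursAt (pos m) (0F ∷ tops b ++ y ∷ [])
  Flank⇒occurs-at-block false m e         = 𝐮-pos m , trans (𝐮-pos+1 m) e , tt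
  Flank⇒occurs-at-block true  m (e , e′)  = 𝐮-pos m , trans (𝐮-pos+1 m) e , trans (𝐮-pos+2 m) e′ , tt

  FlankImage : Bool → Bool → Pred (A × A) 0ℓ → Pred (A × A) 0ℓ
  FlankImage bl br E (x , y) = ∃[ a ] ∃[ b ] (E (a , b) × Flank bl a x × Flank br b y)

  imageWord-++ : (bl br : Bool) (v ys : List A) → imageWord bl br v ++ ys ≡ tops bl ++ φ n v ++ 0F ∷ tops br ++ ys
  imageWord-++ bl br v ys =
    trans (++-assoc (tops bl) (φ n v ++ 0F ∷ tops br) ys) (cong (tops bl ++_) (++-assoc (φ n v) (0F ∷ tops br) ys))

  Ext-imageWord⁻ : (bl br : Bool) (v : List A) → Ext (imageWord bl br v) ⊆ FlankImage bl br (Ext v)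
  Ext-imageWord⁻ bl br v {x , y} (q , ex , o) = from-block (𝐮≡0F⇒pos _ (φ-++-0F-occurs _ v _ o-image))
    where
    o-split : OccursAt (suc q) (tops bl ++ φ n v ++ 0F ∷ tops br ++ y ∷ [])
    o-split = subst (OccursAt (suc q)) (imageWord-++ bl br v (y ∷ [])) o
    o-image : OccursAt (suc q + length (tops bl)) (φ n v ++ 0F ∷ tops br ++ y ∷ [])
    o-image = occurs-++⁻ʳ (suc q) (tops bl) _ o-split
    from-block : ∃[ m ] suc q + length (tops bl) ≡ pos m → FlankImage bl br (Ext v) (x , y)
    from-block (suc m , start≡) =
      𝐮 m , 𝐮 (suc m + length v) , (m , refl , occurs-++⁺ (suc m) v _ o-v (refl , tt)) , left , right
      where
      left : Flank bl (𝐮 m) x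
      left = occurs-before-block⇒Flank bl m (ex , occurs-++⁻ˡ (suc q) (tops bl) _ o-split) start≡
      o-v : OccursAt (suc m) v
      o-v = φ-desubstitute (suc m) v _ (occurs-cong start≡ o-image)
      right : Flank br (𝐮 (suc m + length v)) y
      right = occurs-at-block⇒Flank br (suc m + length v) (occurs-cong (sym (pos-+-length (suc m) v o-v))
                (occurs-++⁻ʳ (pos (suc m)) (φ n v) _ (occurs-cong start≡ o-image)))

  Ext-imageWord⁺ : (bl br : Bool) (v : List A) → FlankImage bl br (Ext v) ⊆ Ext (imageWord bl br v)
  Ext-imageWord⁺ bl br v {x , y} (a , b , (m , refl , o) , left , right) with Flank⇒occurs-before-block bl m left
  ... | q , start≡ , ex , o-left = q , ex , subst (OccursAt (suc q)) (sym (imageWord-++ bl br v (y ∷ [])))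
          (occurs-++⁺ (suc q) (tops bl) _ o-left (occurs-cong (sym start≡)
            (occurs-++⁺ (pos (suc m)) (φ n v) _ (φ-occurs (suc m) v o-v) (occurs-cong end≡ o-right))))
    where
    o-v : OccursAt (suc m) v
    o-v = occurs-++⁻ˡ (suc m) v _ o
    end≡ : pos (suc m + length v) ≡ pos (suc m) + length (φ n v)
    end≡ = pos-+-length (suc m) v o-v
    o-right : OccursAt (pos (suc m + length v)) (0F ∷ tops br ++ y ∷ [])
    o-right = Flank⇒occurs-at-block br (suc m + length v)
                (Flank-𝐮 br (suc m + length v) (proj₁ (occurs-++⁻ʳ (suc m) v _ o)) right)

  LeftSpecial RightSpecial Bispecial : Pred (A × A) 0ℓ → Set
  LeftSpecial  E = ∃[ x₁ ] ∃[ y₁ ] ∃[ x₂ ] ∃[ y₂ ] (E (x₁ , y₁) × E (x₂ , y₂) × x₁ ≢ x₂)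
  RightSpecial E = ∃[ x₁ ] ∃[ y₁ ] ∃[ x₂ ] ∃[ y₂ ] (E (x₁ , y₁) × E (x₂ , y₂) × y₁ ≢ y₂)
  Bispecial    E = LeftSpecial E × RightSpecial E

  LeftSpecial⇒nonzero : {E : Pred (A × A) 0ℓ} → LeftSpecial E → ∃[ x ] ∃[ y ] (E (x , y) × x ≢ 0F)
  LeftSpecial⇒nonzero (x₁ , y₁ , x₂ , y₂ , e₁ , e₂ , x₁≢x₂) with x₁ ≟ᶠ 0F
  ... | yes refl = x₂ , y₂ , e₂ , λ x₂≡0F → x₁≢x₂ (sym x₂≡0F)
  ... | no x₁≢0F = x₁ , y₁ , e₁ , x₁≢0F

  RightSpecial⇒nonzero : {E : Pred (A × A) 0ℓ} → RightSpecial E → ∃[ x ] ∃[ y ] (E (x , y) × y ≢ 0F)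
  RightSpecial⇒nonzero (x₁ , y₁ , x₂ , y₂ , e₁ , e₂ , y₁≢y₂) with y₁ ≟ᶠ 0F
  ... | yes refl = x₂ , y₂ , e₂ , λ y₂≡0F → y₁≢y₂ (sym y₂≡0F)
  ... | no y₁≢0F = x₁ , y₁ , e₁ , y₁≢0F

  left-form : (w : List A) {x y : A} → Ext w (x , y) → x ≢ 0F
            → w ≡ [] ⊎ w ≡ top ∷ [] ⊎ ∃[ bl ] ∃[ r ] w ≡ tops bl ++ 0F ∷ r
  left-form [] _ _ = inj₁ refl
  left-form (c ∷ w′) (q , o) x≢0F with c ≟ᶠ 0F | w′
  ... | yes refl | _     = inj₂ (inj₂ (false , _ , refl))
  ... | no c≢0F  | []    = inj₂ (inj₁ (cong (_∷ []) (proj₁ (nonzero-pair⇒top-0F q o x≢0F c≢0F))))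
  ... | no c≢0F  | d ∷ t with nonzero-pair⇒top-0F q (occurs-++⁻ˡ q (_ ∷ c ∷ d ∷ []) _ o) x≢0F c≢0F
  ...   | refl , refl = inj₂ (inj₂ (true , t , refl))

  ∷ʳ-∷ʳ-++ : (w : List A) {d c : A} (ys : List A) → ((w ∷ʳ d) ∷ʳ c) ++ ys ≡ w ++ d ∷ c ∷ ys
  ∷ʳ-∷ʳ-++ w {d} {c} ys = trans (++-assoc (w ∷ʳ d) (c ∷ []) ys) (++-assoc w (d ∷ []) (c ∷ ys))

  right-form : (w : List A) {x y : A} → Ext w (x , y) → y ≢ 0F
             → w ≡ [] ⊎ w ≡ top ∷ [] ⊎ ∃[ br ] ∃[ r ] w ≡ r ++ 0F ∷ tops br
  right-form w {x} (q , o) y≢0F with initLast w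
  ... | [] = inj₁ refl
  ... | w₀ ∷ʳ′ c with c ≟ᶠ 0F
  ...   | yes refl = inj₂ (inj₂ (false , w₀ , refl))
  ...   | no c≢0F with initLast w₀
  ...     | [] = inj₂ (inj₁ (cong (_∷ []) (proj₂ (nonzero-pair⇒0F-top q o c≢0F y≢0F))))
  ...     | w₁ ∷ʳ′ d with nonzero-pair⇒0F-top (q + length (x ∷ w₁))
                            (occurs-++⁻ʳ q (x ∷ w₁) _ (subst (OccursAt q) (cong (x ∷_) (∷ʳ-∷ʳ-++ w₁ (_ ∷ []))) o))
                            c≢0F y≢0F
  ...       | refl , refl = inj₂ (inj₂ (true , w₁ , ++-assoc w₁ (0F ∷ []) (top ∷ [])))

  zero-at-block : (p : ℕ) (xs ys : List A) → OccursAt p (xs ++ 0F ∷ ys) → ∃[ m ] p + length xs ≡ pos m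
  zero-at-block p xs ys o = 𝐮≡0F⇒pos _ (proj₁ (occurs-++⁻ʳ p xs _ o))

  block-span : (m₁ m₂ : ℕ) → m₁ ≤ m₂ → ∃[ v ] (OccursAt (pos m₁) (φ n v) × pos m₂ ≡ pos m₁ + length (φ n v))
  block-span m₁ m₂ m₁≤m₂ = v , φ-occurs m₁ v o-v , trans (cong pos (sym m₁+|v|≡m₂)) (pos-+-length m₁ v o-v)
    where
    v = segment m₁ (m₂ ∸ m₁)
    o-v = occurs-segment m₁ (m₂ ∸ m₁)
    m₁+|v|≡m₂ : m₁ + length v ≡ m₂
    m₁+|v|≡m₂ = trans (cong (m₁ +_) (length-segment m₁ (m₂ ∸ m₁))) (m+[n∸m]≡n m₁≤m₂)

  length-imageWord : (bl br : Bool) (v : List A)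
    → length (imageWord bl br v) ≡ length (tops bl) + length (φ n v) + suc (length (tops br))
  length-imageWord bl br v = begin
    length (tops bl ++ φ n v ++ 0F ∷ tops br)                    ≡⟨ length-++ (tops bl) ⟩
    length (tops bl) + length (φ n v ++ 0F ∷ tops br)            ≡⟨ cong (length (tops bl) +_) (length-++ (φ n v)) ⟩
    length (tops bl) + (length (φ n v) + suc (length (tops br))) ≡⟨ +-assoc (length (tops bl)) _ _ ⟨
    length (tops bl) + length (φ n v) + suc (length (tops br))   ∎
    where open ≡-Reasoning

  length-<-imageWord : (bl br : Bool) (v : List A) → length v < length (imageWord bl br v)
  length-<-imageWord bl br v = begin-strict
    length v                                                     ≤⟨ m≤m+n (length v) (length v + 0) ⟩
    2 * length v                                                 ≤⟨ length-φ v ⟩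
    length (φ n v)                                               ≤⟨ m≤n+m _ (length (tops bl)) ⟩
    length (tops bl) + length (φ n v)                            <⟨ m<m+n _ (s≤s z≤n) ⟩
    length (tops bl) + length (φ n v) + suc (length (tops br))   ≡⟨ length-imageWord bl br v ⟨
    length (imageWord bl br v)                                   ∎
    where open ≤-Reasoning

  tops-before-0F : (bl : Bool) {br : Bool} (r₁ r₂ : List A)
    → tops bl ++ 0F ∷ r₁ ≡ r₂ ++ 0F ∷ tops br → length (tops bl) ≤ length r₂
  tops-before-0F false r₁ r₂       _ = z≤n
  tops-before-0F true  r₁ []       e = contradiction (∷-injectiveˡ e) (top≢0F 1≤n)
  tops-before-0F true  r₁ (_ ∷ r₂) _ = s≤s z≤n

  imageWord-decomposition : (p : ℕ) (bl br : Bool) {w r₁ r₂ : List A} → OccursAt p w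
    → w ≡ tops bl ++ 0F ∷ r₁ → w ≡ r₂ ++ 0F ∷ tops br → ∃[ v ] w ≡ imageWord bl br v
  imageWord-decomposition p bl br {w} {r₁} {r₂} o refl w≡r
    with zero-at-block p (tops bl) r₁ o | zero-at-block p r₂ (tops br) (subst (OccursAt p) w≡r o)
  ... | m₁ , e₁ | m₂ , e₂
      with block-span m₁ m₂ (pos-cancel-≤ {m₁} {m₂} (subst₂ _≤_ e₁ e₂ (+-monoʳ-≤ p (tops-before-0F bl r₁ r₂ w≡r))))
  ... | v , o-φv , span = v , occurs-unique p o o-image |w|≡
    where
    o-image : OccursAt p (imageWord bl br v)
    o-image = occurs-++⁺ p (tops bl) _ (occurs-++⁻ˡ p (tops bl) _ o)
                (occurs-cong (sym e₁) (occurs-++⁺ (pos m₁) (φ n v) _ o-φv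
                  (occurs-cong (trans e₂ span) (occurs-++⁻ʳ p r₂ _ (subst (OccursAt p) w≡r o)))))
    |r₂|≡ : length r₂ ≡ length (tops bl) + length (φ n v)
    |r₂|≡ = +-cancelˡ-≡ p _ _ (begin
      p + length r₂                              ≡⟨ trans e₂ span ⟩
      pos m₁ + length (φ n v)                    ≡⟨ cong (_+ length (φ n v)) e₁ ⟨
      p + length (tops bl) + length (φ n v)      ≡⟨ +-assoc p _ _ ⟩
      p + (length (tops bl) + length (φ n v))    ∎)
      where open ≡-Reasoning
    |w|≡ : length (tops bl ++ 0F ∷ r₁) ≡ length (imageWord bl br v)
    |w|≡ = begin
      length (tops bl ++ 0F ∷ r₁)                                 ≡⟨ cong length w≡r ⟩
      length (r₂ ++ 0F ∷ tops br)                                 ≡⟨ length-++ r₂ ⟩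
      length r₂ + suc (length (tops br))                          ≡⟨ cong (_+ suc (length (tops br))) |r₂|≡ ⟩
      length (tops bl) + length (φ n v) + suc (length (tops br))  ≡⟨ length-imageWord bl br v ⟨
      length (imageWord bl br v)                                  ∎
      where open ≡-Reasoning

  data BispecialForm : List A → Set where
    empty     : BispecialForm []
    singleTop : BispecialForm (top ∷ [])
    image     : (bl br : Bool) (v : List A) → BispecialForm (imageWord bl br v)

  bispecialForm : (w : List A) → Bispecial (Ext w) → BispecialForm w
  bispecialForm w (left , right) with LeftSpecial⇒nonzero left | RightSpecial⇒nonzero right
  ... | _ , _ , ext-x , x≢0F | _ , _ , ext-y , y≢0F with left-form w ext-x x≢0F | right-form w ext-y y≢0F
  ... | inj₁ refl        | _                = empty
  ... | inj₂ (inj₁ refl) | _                = singleTop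
  ... | _                | inj₁ refl        = empty
  ... | _                | inj₂ (inj₁ refl) = singleTop
  ... | inj₂ (inj₂ (bl , r₁ , w≡l)) | inj₂ (inj₂ (br , r₂ , w≡r))
      with imageWord-decomposition (suc (proj₁ ext-x)) bl br (occurs-++⁻ˡ _ w _ (proj₂ (proj₂ ext-x))) w≡l w≡r
  ...   | v , refl = image bl br v

module Families (n : ℕ) (1≤n : 1 ≤ n) where
  open Morphism n
  open Extensions n 1≤n

  FlankImage-cong : (bl br : Bool) {E F : Pred (A × A) 0ℓ} → E ≐ F → FlankImage bl br E ≐ FlankImage bl br F
  FlankImage-cong bl br (E⊆F , F⊆E) = (λ (a , b , e , l , r) → a , b , E⊆F e , l , r)
                                     , (λ (a , b , f , l , r) → a , b , F⊆E f , l , r)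

  Bispecial-mono : {E F : Pred (A × A) 0ℓ} → E ⊆ F → Bispecial E → Bispecial F
  Bispecial-mono E⊆F ((x₁ , y₁ , x₂ , y₂ , e₁ , e₂ , x₁≢x₂) , (x₃ , y₃ , x₄ , y₄ , e₃ , e₄ , y₃≢y₄)) =
    (x₁ , y₁ , x₂ , y₂ , E⊆F e₁ , E⊆F e₂ , x₁≢x₂) , (x₃ , y₃ , x₄ , y₄ , E⊆F e₃ , E⊆F e₄ , y₃≢y₄)

  Bispecial-preimage : (bl br : Bool) {E : Pred (A × A) 0ℓ} → Bispecial (FlankImage bl br E) → Bispecial E
  Bispecial-preimage bl br
    ((_ , _ , _ , _ , (a₁ , b₁ , e₁ , l₁ , _) , (a₂ , b₂ , e₂ , l₂ , _) , x₁≢x₂) ,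
     (_ , _ , _ , _ , (a₃ , b₃ , e₃ , _ , r₃) , (a₄ , b₄ , e₄ , _ , r₄) , y₃≢y₄)) =
    (a₁ , b₁ , a₂ , b₂ , e₁ , e₂ , λ { refl → x₁≢x₂ (Flank-functional bl l₁ l₂) }) ,
    (a₃ , b₃ , a₄ , b₄ , e₃ , e₄ , λ { refl → y₃≢y₄ (Flank-functional br r₃ r₄) })

  ¬LeftSpecial : {E : Pred (A × A) 0ℓ} (z : A) → (∀ {x y} → E (x , y) → x ≡ z) → ¬ LeftSpecial E
  ¬LeftSpecial z left≡z (_ , _ , _ , _ , e₁ , e₂ , x₁≢x₂) = x₁≢x₂ (trans (left≡z e₁) (sym (left≡z e₂)))

  ¬RightSpecial : {E : Pred (A × A) 0ℓ} (z : A) → (∀ {x y} → E (x , y) → y ≡ z) → ¬ RightSpecial E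
  ¬RightSpecial z right≡z (_ , _ , _ , _ , e₁ , e₂ , y₁≢y₂) = y₁≢y₂ (trans (right≡z e₁) (sym (right≡z e₂)))

  data Family : Set where
    fan    : (k : ℕ) → k < n → Family
    corner : (x y x′ y′ : A) → x ≢ x′ → y ≢ y′ → Family

  ⟦_⟧ : Family → Pred (A × A) 0ℓ
  ⟦ fan k _ ⟧              (x , y) = (toℕ x ≡ k × k < toℕ y) ⊎ (toℕ y ≡ k × k < toℕ x) ⊎ (x ≡ top × y ≡ top)
  ⟦ corner x y x′ y′ _ _ ⟧ (a , b) = (a ≡ x × b ≡ y) ⊎ (a ≡ x × b ≡ y′) ⊎ (a ≡ x′ × b ≡ y)

  InFamily : Pred (A × A) 0ℓ → Set
  InFamily E = ∃[ c ] E ≐ ⟦ c ⟧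

  penultimate : A
  penultimate = fromℕ< (s≤s (m∸n≤m n 1))

  1+penultimate≡n : suc (toℕ penultimate) ≡ n
  1+penultimate≡n = trans (cong suc (toℕ-fromℕ< _)) (m+[n∸m]≡n 1≤n)

  Flank-distinct : (b : Bool) {x x′ a₁ a₂ z₁ z₂ : A} → a₁ ≡ x ⊎ a₁ ≡ x′ → a₂ ≡ x ⊎ a₂ ≡ x′
    → Flank b a₁ z₁ → Flank b a₂ z₂ → z₁ ≢ z₂ → ∃[ X ] ∃[ X′ ] (Flank b x X × Flank b x′ X′ × X ≢ X′)
  Flank-distinct b (inj₁ refl) (inj₁ refl) f₁ f₂ z₁≢z₂ = contradiction (Flank-functional b f₁ f₂) z₁≢z₂
  Flank-distinct b (inj₁ refl) (inj₂ refl) f₁ f₂ z₁≢z₂ = _ , _ , f₁ , f₂ , z₁≢z₂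
  Flank-distinct b (inj₂ refl) (inj₁ refl) f₁ f₂ z₁≢z₂ = _ , _ , f₂ , f₁ , λ e → z₁≢z₂ (sym e)
  Flank-distinct b (inj₂ refl) (inj₂ refl) f₁ f₂ z₁≢z₂ = contradiction (Flank-functional b f₁ f₂) z₁≢z₂

  module _ {x y x′ y′ : A} {x≢x′ : x ≢ x′} {y≢y′ : y ≢ y′} where
    private
      C = corner x y x′ y′ x≢x′ y≢y′

      left∈ : {a b : A} → ⟦ C ⟧ (a , b) → a ≡ x ⊎ a ≡ x′
      left∈ (inj₁ (e , _))        = inj₁ e
      left∈ (inj₂ (inj₁ (e , _))) = inj₁ e
      left∈ (inj₂ (inj₂ (e , _))) = inj₂ e

      right∈ : {a b : A} → ⟦ C ⟧ (a , b) → b ≡ y ⊎ b ≡ y′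
      right∈ (inj₁ (_ , e))        = inj₁ e
      right∈ (inj₂ (inj₁ (_ , e))) = inj₂ e
      right∈ (inj₂ (inj₂ (_ , e))) = inj₁ e

    corner-image : (bl br : Bool) → Bispecial (FlankImage bl br ⟦ C ⟧) → InFamily (FlankImage bl br ⟦ C ⟧)
    corner-image bl br
      ((_ , _ , _ , _ , (_ , _ , e₁ , l₁ , _) , (_ , _ , e₂ , l₂ , _) , x₁≢x₂) ,
       (_ , _ , _ , _ , (_ , _ , e₃ , _ , r₃) , (_ , _ , e₄ , _ , r₄) , y₃≢y₄))
      with Flank-distinct bl (left∈ e₁) (left∈ e₂) l₁ l₂ x₁≢x₂ | Flank-distinct br (right∈ e₃) (right∈ e₄) r₃ r₄ y₃≢y₄
    ... | X , X′ , lX , lX′ , X≢X′ | Y , Y′ , lY , lY′ , Y≢Y′ = corner X Y X′ Y′ X≢X′ Y≢Y′ , to , from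
      where
      to : FlankImage bl br ⟦ C ⟧ ⊆ ⟦ corner X Y X′ Y′ X≢X′ Y≢Y′ ⟧
      to (_ , _ , inj₁ (refl , refl)        , l , r) = inj₁ (Flank-functional bl l lX , Flank-functional br r lY)
      to (_ , _ , inj₂ (inj₁ (refl , refl)) , l , r) = inj₂ (inj₁ (Flank-functional bl l lX , Flank-functional br r lY′))
      to (_ , _ , inj₂ (inj₂ (refl , refl)) , l , r) = inj₂ (inj₂ (Flank-functional bl l lX′ , Flank-functional br r lY))
      from : ⟦ corner X Y X′ Y′ X≢X′ Y≢Y′ ⟧ ⊆ FlankImage bl br ⟦ C ⟧
      from (inj₁ (refl , refl))        = x  , y  , inj₁ (refl , refl)        , lX  , lY
      from (inj₂ (inj₁ (refl , refl))) = x  , y′ , inj₂ (inj₁ (refl , refl)) , lX  , lY′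
      from (inj₂ (inj₂ (refl , refl))) = x′ , y  , inj₂ (inj₂ (refl , refl)) , lX′ , lY

  module FanImage (k : ℕ) (k<n : k < n) where
    F = ⟦ fan k k<n ⟧

    kk : A
    kk = fromℕ< (s≤s (<⇒≤ k<n))

    toℕ-kk : toℕ kk ≡ k
    toℕ-kk = toℕ-fromℕ< (s≤s (<⇒≤ k<n))

    k<top : k < toℕ top
    k<top = subst (k <_) (sym toℕ-top) k<n

    fan-left : {a b : A} → F (a , b) → k ≤ toℕ a
    fan-left (inj₁ (a≡k , _))        = ≤-reflexive (sym a≡k)
    fan-left (inj₂ (inj₁ (_ , k<a))) = <⇒≤ k<a
    fan-left (inj₂ (inj₂ (refl , _))) = <⇒≤ k<top

    fan-right : {a b : A} → F (a , b) → k ≤ toℕ b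
    fan-right (inj₁ (_ , k<b))        = <⇒≤ k<b
    fan-right (inj₂ (inj₁ (b≡k , _))) = ≤-reflexive (sym b≡k)
    fan-right (inj₂ (inj₂ (_ , refl))) = <⇒≤ k<top

    toℕ-σ-k : {a : A} → toℕ a ≡ k → toℕ (σ a) ≡ suc k
    toℕ-σ-k a≡k = trans (toℕ-σ (subst (_< n) (sym a≡k) k<n)) (cong suc a≡k)

    module _ (1+k<n : suc k < n) where
      K : A
      K = fromℕ< (s≤s (<⇒≤ 1+k<n))

      toℕ-K : toℕ K ≡ suc k
      toℕ-K = toℕ-fromℕ< (s≤s (<⇒≤ 1+k<n))

      K≢top : K ≢ top
      K≢top K≡top = <⇒≢ 1+k<n (trans (sym toℕ-K) (trans (cong toℕ K≡top) toℕ-top))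

      σ≡K : {a : A} → toℕ a ≡ k → σ a ≡ K
      σ≡K a≡k = toℕ-injective (trans (toℕ-σ-k a≡k) (sym toℕ-K))

      ¬Flank-true-k : {a x : A} → toℕ a ≡ k → ¬ Flank true a x
      ¬Flank-true-k a≡k (σa≡top , _) = K≢top (trans (sym (σ≡K a≡k)) σa≡top)

      k<penultimate : k < toℕ penultimate
      k<penultimate = s≤s⁻¹ (subst (suc k <_) (sym 1+penultimate≡n) 1+k<n)

      fan-σσ : FlankImage false false F ≐ ⟦ fan (suc k) 1+k<n ⟧
      fan-σσ = to , from
        where
        to : FlankImage false false F ⊆ ⟦ fan (suc k) 1+k<n ⟧
        to (a , b , inj₁ (a≡k , k<b)        , refl , refl) = inj₁ (toℕ-σ-k a≡k , σ-mono b k<b 1+k<n)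
        to (a , b , inj₂ (inj₁ (b≡k , k<a)) , refl , refl) = inj₂ (inj₁ (toℕ-σ-k b≡k , σ-mono a k<a 1+k<n))
        to (a , b , inj₂ (inj₂ (refl , refl)) , refl , refl) = inj₂ (inj₂ (σ-top , σ-top))
        from : ⟦ fan (suc k) 1+k<n ⟧ ⊆ FlankImage false false F
        from (inj₁ (x≡1+k , 1+k<y)) with σ-preimage-≡ x≡1+k | σ-preimage-> 1+k<y
        ... | a , a≡k , refl | b , k<b , refl = a , b , inj₁ (a≡k , k<b) , refl , refl
        from (inj₂ (inj₁ (y≡1+k , 1+k<x))) with σ-preimage-> 1+k<x | σ-preimage-≡ y≡1+k
        ... | a , k<a , refl | b , b≡k , refl = a , b , inj₂ (inj₁ (b≡k , k<a)) , refl , refl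
        from (inj₂ (inj₂ (refl , refl))) = top , top , inj₂ (inj₂ (refl , refl)) , σ-top , σ-top

      fan-στ : FlankImage false true F ≐ ⟦ corner K top top 0F K≢top (top≢0F 1≤n) ⟧
      fan-στ = to , from
        where
        to : FlankImage false true F ⊆ ⟦ corner K top top 0F K≢top (top≢0F 1≤n) ⟧
        to (a , b , inj₁ (a≡k , _) , refl , r) with below-or-top b
        ... | inj₁ b<n = inj₂ (inj₁ (σ≡K a≡k , Flank-true-below b<n r))
        ... | inj₂ refl = inj₁ (σ≡K a≡k , Flank-true-top r)
        to (a , b , inj₂ (inj₁ (b≡k , _)) , _ , r) = contradiction r (¬Flank-true-k b≡k)
        to (a , b , inj₂ (inj₂ (refl , refl)) , refl , r) = inj₂ (inj₂ (σ-top , Flank-true-top r))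
        from : ⟦ corner K top top 0F K≢top (top≢0F 1≤n) ⟧ ⊆ FlankImage false true F
        from (inj₁ (refl , refl))        = kk , top , inj₁ (toℕ-kk , k<top) , σ≡K toℕ-kk , Flank-top true
        from (inj₂ (inj₁ (refl , refl))) =
          kk , penultimate , inj₁ (toℕ-kk , k<penultimate) , σ≡K toℕ-kk , Flank-true-penultimate 1+penultimate≡n
        from (inj₂ (inj₂ (refl , refl))) = top , top , inj₂ (inj₂ (refl , refl)) , σ-top , Flank-top true

      fan-τσ : FlankImage true false F ≐ ⟦ corner top K 0F top (top≢0F 1≤n) K≢top ⟧
      fan-τσ = to , from
        where
        to : FlankImage true false F ⊆ ⟦ corner top K 0F top (top≢0F 1≤n) K≢top ⟧
        to (a , b , inj₁ (a≡k , _) , l , _) = contradiction l (¬Flank-true-k a≡k)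
        to (a , b , inj₂ (inj₁ (b≡k , _)) , l , refl) with below-or-top a
        ... | inj₁ a<n = inj₂ (inj₂ (Flank-true-below a<n l , σ≡K b≡k))
        ... | inj₂ refl = inj₁ (Flank-true-top l , σ≡K b≡k)
        to (a , b , inj₂ (inj₂ (refl , refl)) , l , refl) = inj₂ (inj₁ (Flank-true-top l , σ-top))
        from : ⟦ corner top K 0F top (top≢0F 1≤n) K≢top ⟧ ⊆ FlankImage true false F
        from (inj₁ (refl , refl))        = top , kk , inj₂ (inj₁ (toℕ-kk , k<top)) , Flank-top true , σ≡K toℕ-kk
        from (inj₂ (inj₁ (refl , refl))) = top , top , inj₂ (inj₂ (refl , refl)) , Flank-top true , σ-top
        from (inj₂ (inj₂ (refl , refl))) =
          penultimate , kk , inj₂ (inj₁ (toℕ-kk , k<penultimate)) , Flank-true-penultimate 1+penultimate≡n , σ≡K toℕ-kk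

      fan-ττ-left : {x y : A} → FlankImage true true F (x , y) → x ≡ top
      fan-ττ-left (a , b , inj₁ (a≡k , _)        , l , _) = contradiction l (¬Flank-true-k a≡k)
      fan-ττ-left (a , b , inj₂ (inj₁ (b≡k , _)) , _ , r) = contradiction r (¬Flank-true-k b≡k)
      fan-ττ-left (a , b , inj₂ (inj₂ (refl , refl)) , l , _) = Flank-true-top l

    module _ (1+k≡n : suc k ≡ n) where
      σ-saturates-fan : {a : A} → k ≤ toℕ a → σ a ≡ top
      σ-saturates-fan {a} k≤a = σ-saturates a (subst (_≤ suc (toℕ a)) 1+k≡n (s≤s k≤a))

      fan-σ-left : (br : Bool) {x y : A} → FlankImage false br F (x , y) → x ≡ top
      fan-σ-left br (a , _ , e , refl , _) = σ-saturates-fan (fan-left e)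

      fan-σ-right : (bl : Bool) {x y : A} → FlankImage bl false F (x , y) → y ≡ top
      fan-σ-right bl (_ , b , e , _ , refl) = σ-saturates-fan (fan-right e)

      above-k⇒top : {a : A} → k < toℕ a → a ≡ top
      above-k⇒top {a} k<a = toℕ≡n⇒≡top (≤-antisym (toℕ≤n a) (subst (_≤ toℕ a) 1+k≡n k<a))

      fan-ττ : FlankImage true true F ≐ ⟦ corner top top 0F 0F (top≢0F 1≤n) (top≢0F 1≤n) ⟧
      fan-ττ = to , from
        where
        Flank-true-kk : Flank true kk 0F
        Flank-true-kk = Flank-true-penultimate (trans (cong suc toℕ-kk) 1+k≡n)
        to : FlankImage true true F ⊆ ⟦ corner top top 0F 0F (top≢0F 1≤n) (top≢0F 1≤n) ⟧
        to (a , b , inj₁ (a≡k , k<b) , l , r) with above-k⇒top k<b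
        ... | refl = inj₂ (inj₂ (Flank-true-below (subst (_< n) (sym a≡k) k<n) l , Flank-true-top r))
        to (a , b , inj₂ (inj₁ (b≡k , k<a)) , l , r) with above-k⇒top k<a
        ... | refl = inj₂ (inj₁ (Flank-true-top l , Flank-true-below (subst (_< n) (sym b≡k) k<n) r))
        to (a , b , inj₂ (inj₂ (refl , refl)) , l , r) = inj₁ (Flank-true-top l , Flank-true-top r)
        from : ⟦ corner top top 0F 0F (top≢0F 1≤n) (top≢0F 1≤n) ⟧ ⊆ FlankImage true true F
        from (inj₁ (refl , refl))        = top , top , inj₂ (inj₂ (refl , refl)) , Flank-top true , Flank-top true
        from (inj₂ (inj₁ (refl , refl))) = top , kk , inj₂ (inj₁ (toℕ-kk , k<top)) , Flank-top true , Flank-true-kk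
        from (inj₂ (inj₂ (refl , refl))) = kk , top , inj₁ (toℕ-kk , k<top) , Flank-true-kk , Flank-top true

    fan-image : (bl br : Bool) → Bispecial (FlankImage bl br F) → InFamily (FlankImage bl br F)
    fan-image bl br B with m≤n⇒m<n∨m≡n k<n
    fan-image false false B | inj₁ 1+k<n = fan (suc k) 1+k<n , fan-σσ 1+k<n
    fan-image false true  B | inj₁ 1+k<n = corner (K 1+k<n) top top 0F (K≢top 1+k<n) (top≢0F 1≤n) , fan-στ 1+k<n
    fan-image true  false B | inj₁ 1+k<n = corner top (K 1+k<n) 0F top (top≢0F 1≤n) (K≢top 1+k<n) , fan-τσ 1+k<n
    fan-image true  true  B | inj₁ 1+k<n = contradiction (proj₁ B) (¬LeftSpecial top (fan-ττ-left 1+k<n))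
    fan-image false br    B | inj₂ 1+k≡n = contradiction (proj₁ B) (¬LeftSpecial top (fan-σ-left 1+k≡n br))
    fan-image true  false B | inj₂ 1+k≡n = contradiction (proj₂ B) (¬RightSpecial top (fan-σ-right 1+k≡n true))
    fan-image true  true  B | inj₂ 1+k≡n = corner top top 0F 0F (top≢0F 1≤n) (top≢0F 1≤n) , fan-ττ 1+k≡n

  open FanImage using (fan-image)

  family-image : (c : Family) (bl br : Bool) → Bispecial (FlankImage bl br ⟦ c ⟧) → InFamily (FlankImage bl br ⟦ c ⟧)
  family-image (fan k k<n)                   = fan-image k k<n
  family-image (corner x y x′ y′ x≢x′ y≢y′) = corner-image {x≢x′ = x≢x′} {y≢y′ = y≢y′}

  record Ordinary (E : Pred (A × A) 0ℓ) : Set where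
    field
      lefts  : List A
      rights : List A
      pairs  : List (A × A)
      lefts-enum  : Enumerates (λ x → ∃[ y ] E (x , y)) lefts
      rights-enum : Enumerates (λ y → ∃[ x ] E (x , y)) rights
      pairs-enum  : Enumerates E pairs
      count : length pairs + 1 ≡ length lefts + length rights

  Enumerates-resp : {X : Set} {P Q : Pred X 0ℓ} {xs : List X} → P ≐ Q → Enumerates P xs → Enumerates Q xs
  Enumerates-resp (P⊆Q , Q⊆P) (unique , ∈⇔) =
    unique , λ x → mk⇔ (λ x∈ → P⊆Q (Equivalence.to (∈⇔ x) x∈)) (λ qx → Equivalence.from (∈⇔ x) (Q⊆P qx))

  Ordinary-resp : {E F : Pred (A × A) 0ℓ} → E ≐ F → Ordinary E → Ordinary F
  Ordinary-resp (E⊆F , F⊆E) o = record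
    { lefts = lefts ; rights = rights ; pairs = pairs
    ; lefts-enum  = Enumerates-resp ((λ (y , e) → y , E⊆F e) , (λ (y , f) → y , F⊆E f)) lefts-enum
    ; rights-enum = Enumerates-resp ((λ (x , e) → x , E⊆F e) , (λ (x , f) → x , F⊆E f)) rights-enum
    ; pairs-enum  = Enumerates-resp (E⊆F , F⊆E) pairs-enum
    ; count = count
    }
    where open Ordinary o

  corner-ordinary : (x y x′ y′ : A) (x≢x′ : x ≢ x′) (y≢y′ : y ≢ y′) → Ordinary ⟦ corner x y x′ y′ x≢x′ y≢y′ ⟧
  corner-ordinary x y x′ y′ x≢x′ y≢y′ = record
    { lefts = x ∷ x′ ∷ [] ; rights = y ∷ y′ ∷ [] ; pairs = (x , y) ∷ (x , y′) ∷ (x′ , y) ∷ []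
    ; lefts-enum = ((x≢x′ ∷ []) ∷ [] ∷ []) , λ a → mk⇔
        (λ { (here refl) → y , inj₁ (refl , refl) ; (there (here refl)) → y , inj₂ (inj₂ (refl , refl)) })
        (λ { (_ , inj₁ (refl , _)) → here refl ; (_ , inj₂ (inj₁ (refl , _))) → here refl
           ; (_ , inj₂ (inj₂ (refl , _))) → there (here refl) })
    ; rights-enum = ((y≢y′ ∷ []) ∷ [] ∷ []) , λ b → mk⇔
        (λ { (here refl) → x , inj₁ (refl , refl) ; (there (here refl)) → x , inj₂ (inj₁ (refl , refl)) })
        (λ { (_ , inj₁ (_ , refl)) → here refl ; (_ , inj₂ (inj₁ (_ , refl))) → there (here refl)
           ; (_ , inj₂ (inj₂ (_ , refl))) → here refl })
    ; pairs-enum = ((y≢y′ ∘ cong proj₂ ∷ x≢x′ ∘ cong proj₁ ∷ []) ∷ (x≢x′ ∘ cong proj₁ ∷ []) ∷ [] ∷ []) , λ p → mk⇔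
        (λ { (here refl) → inj₁ (refl , refl) ; (there (here refl)) → inj₂ (inj₁ (refl , refl))
           ; (there (there (here refl))) → inj₂ (inj₂ (refl , refl)) })
        (λ { (inj₁ (refl , refl)) → here refl ; (inj₂ (inj₁ (refl , refl))) → there (here refl)
           ; (inj₂ (inj₂ (refl , refl))) → there (there (here refl)) })
    ; count = refl
    }

  fan-ordinary : (k : ℕ) (k<n : k < n) → Ordinary ⟦ fan k k<n ⟧
  fan-ordinary k k<n = record
    { lefts = kk ∷ above ; rights = kk ∷ above ; pairs = pairs
    ; lefts-enum = kk∷above-unique , λ a → mk⇔
        (λ { (here refl) → top , inj₁ (toℕ-kk , k<top) ; (there a∈) → kk , inj₂ (inj₁ (toℕ-kk , ∈-above⁻ a∈)) })
        (λ { (_ , inj₁ (a≡k , _)) → here (≡kk a≡k) ; (_ , inj₂ (inj₁ (_ , k<a))) → there (∈-above⁺ k<a)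
           ; (_ , inj₂ (inj₂ (refl , _))) → there (∈-above⁺ k<top) })
    ; rights-enum = kk∷above-unique , λ b → mk⇔
        (λ { (here refl) → top , inj₂ (inj₁ (toℕ-kk , k<top)) ; (there b∈) → kk , inj₁ (toℕ-kk , ∈-above⁻ b∈) })
        (λ { (_ , inj₁ (_ , k<b)) → there (∈-above⁺ k<b) ; (_ , inj₂ (inj₁ (b≡k , _))) → here (≡kk b≡k)
           ; (_ , inj₂ (inj₂ (_ , refl))) → there (∈-above⁺ k<top) })
    ; pairs-enum = pairs-unique , λ p → mk⇔ pair∈⇒ pair∈⇐
    ; count = count
    }
    where
    open FanImage k k<n using (kk; toℕ-kk; k<top)

    above : List A
    above = filter (λ a → k <? toℕ a) (allFin (suc n))

    ∈-above⁺ : {a : A} → k < toℕ a → a ∈ above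
    ∈-above⁺ {a} = ∈-filter⁺ (λ a → k <? toℕ a) (∈-allFin a)

    ∈-above⁻ : {a : A} → a ∈ above → k < toℕ a
    ∈-above⁻ a∈ = proj₂ (∈-filter⁻ (λ a → k <? toℕ a) {xs = allFin (suc n)} a∈)

    ≡kk : {a : A} → toℕ a ≡ k → a ≡ kk
    ≡kk a≡k = toℕ-injective (trans a≡k (sym toℕ-kk))

    kk∉above : kk ∉ above
    kk∉above kk∈ = <-irrefl (sym toℕ-kk) (∈-above⁻ kk∈)

    kk≢top : kk ≢ top
    kk≢top kk≡top = <⇒≢ k<n (trans (sym toℕ-kk) (trans (cong toℕ kk≡top) toℕ-top))

    above-unique : Unique above
    above-unique = Unique.filter⁺ (λ a → k <? toℕ a) (Unique.allFin⁺ (suc n))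

    kk∷above-unique : Unique (kk ∷ above)
    kk∷above-unique = Unique.++⁺ {xs = kk ∷ []} ([] ∷ []) above-unique λ { (here refl , kk∈) → kk∉above kk∈ }

    with-kkˡ with-kkʳ : List (A × A)
    with-kkˡ = map (kk ,_) above
    with-kkʳ = map (_, kk) above

    pairs : List (A × A)
    pairs = with-kkˡ ++ with-kkʳ ++ (top , top) ∷ []

    pairs-unique : Unique pairs
    pairs-unique = Unique.++⁺ (Unique.map⁺ (cong proj₂) above-unique)
                              (Unique.++⁺ (Unique.map⁺ (cong proj₁) above-unique) ([] ∷ []) kkʳ-disjoint) kkˡ-disjoint
      where
      kkʳ-disjoint : {p : A × A} → ¬ (p ∈ with-kkʳ × p ∈ (top , top) ∷ [])
      kkʳ-disjoint (p∈ , here refl) with ∈-map⁻ (_, kk) p∈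
      ... | _ , _ , e = kk≢top (sym (cong proj₂ e))
      kkˡ-disjoint : {p : A × A} → ¬ (p ∈ with-kkˡ × p ∈ with-kkʳ ++ (top , top) ∷ [])
      kkˡ-disjoint (p∈ˡ , p∈) with ∈-map⁻ (kk ,_) p∈ˡ | ∈-++⁻ with-kkʳ p∈
      ... | b , b∈ , refl | inj₁ p∈ʳ with ∈-map⁻ (_, kk) p∈ʳ
      ...   | _ , _ , e = kk∉above (subst (_∈ above) (cong proj₂ e) b∈)
      kkˡ-disjoint (p∈ˡ , p∈) | b , b∈ , refl | inj₂ (here e) = kk≢top (cong proj₁ e)

    pair∈⇒ : {p : A × A} → p ∈ pairs → ⟦ fan k k<n ⟧ p
    pair∈⇒ p∈ with ∈-++⁻ with-kkˡ p∈
    ... | inj₁ p∈ˡ with ∈-map⁻ (kk ,_) p∈ˡ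
    ...   | _ , b∈ , refl = inj₁ (toℕ-kk , ∈-above⁻ b∈)
    pair∈⇒ p∈ | inj₂ p∈′ with ∈-++⁻ with-kkʳ p∈′
    ...   | inj₁ p∈ʳ with ∈-map⁻ (_, kk) p∈ʳ
    ...     | _ , a∈ , refl = inj₂ (inj₁ (toℕ-kk , ∈-above⁻ a∈))
    pair∈⇒ p∈ | inj₂ p∈′ | inj₂ (here refl) = inj₂ (inj₂ (refl , refl))

    pair∈⇐ : {p : A × A} → ⟦ fan k k<n ⟧ p → p ∈ pairs
    pair∈⇐ {a , b} (inj₁ (a≡k , k<b)) rewrite ≡kk a≡k = ∈-++⁺ˡ (∈-map⁺ (kk ,_) (∈-above⁺ k<b))
    pair∈⇐ {a , b} (inj₂ (inj₁ (b≡k , k<a))) rewrite ≡kk b≡k = ∈-++⁺ʳ with-kkˡ (∈-++⁺ˡ (∈-map⁺ (_, kk) (∈-above⁺ k<a)))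
    pair∈⇐ (inj₂ (inj₂ (refl , refl))) = ∈-++⁺ʳ with-kkˡ (∈-++⁺ʳ with-kkʳ (here refl))

    count : length pairs + 1 ≡ length (kk ∷ above) + length (kk ∷ above)
    count = begin
      length pairs + 1                                                  ≡⟨ cong (_+ 1) (length-++ with-kkˡ) ⟩
      length with-kkˡ + length (with-kkʳ ++ (top , top) ∷ []) + 1     ≡⟨ cong (λ l → length with-kkˡ + l + 1) (length-++ with-kkʳ) ⟩
      length with-kkˡ + (length with-kkʳ + 1) + 1                      ≡⟨ cong₂ (λ l r → l + (r + 1) + 1)
                                                                             (length-map (kk ,_) above) (length-map (_, kk) above) ⟩
      length above + (length above + 1) + 1                            ≡⟨ solve 1 (λ a → a :+ (a :+ con 1) :+ con 1 := (con 1 :+ a) :+ (con 1 :+ a))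
                                                                             refl (length above) ⟩
      suc (length above) + suc (length above)                           ∎
      where
      open ≡-Reasoning
      open ℕ-Solver using (solve; _:+_; _:=_; con)

  family-ordinary : (c : Family) → Ordinary ⟦ c ⟧
  family-ordinary (fan k k<n)                = fan-ordinary k k<n
  family-ordinary (corner x y x′ y′ x≢x′ y≢y′) = corner-ordinary x y x′ y′ x≢x′ y≢y′

module Classification (n : ℕ) (1≤n : 1 ≤ n) where
  open Morphism n
  open FixedPoint n
  open Blocks n 1≤n
  open Extensions n 1≤n
  open Families n 1≤n

  nonzero⇒0< : {a : A} → a ≢ 0F → 0 < toℕ a
  nonzero⇒0< {0F}    a≢0F = contradiction refl a≢0F
  nonzero⇒0< {sucF _} _   = s≤s z≤n

  Ext-before-block : (b : Bool) (m : ℕ) {x : A} → Flank b (𝐮 m) x → Ext (tops b) (x , 0F)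
  Ext-before-block b m f with Flank⇒occurs-before-block b m f
  ... | q , end≡ , ex , o = q , ex , occurs-++⁺ (suc q) (tops b) (0F ∷ []) o (occurs-cong (sym end≡) (𝐮-pos (suc m) , tt))

  Ext-at-block : (b : Bool) (m : ℕ) {y : A} → Flank b (𝐮 m) y → Ext (tops b) (0F , y)
  Ext-at-block b m f with Flank⇒occurs-at-block b m f
  ... | e0 , o = pos m , e0 , o

  Ext-ε : Ext [] ≐ ⟦ fan 0 1≤n ⟧
  Ext-ε = to , from
    where
    to : Ext [] ⊆ ⟦ fan 0 1≤n ⟧
    to {x , y} (q , refl , refl , _) with 𝐮 q ≟ᶠ 0F | 𝐮 (suc q) ≟ᶠ 0F
    ... | yes x≡0F | _ with 𝐮≡0F⇒pos q x≡0F
    ...   | m , refl = inj₁ (cong toℕ x≡0F , nonzero⇒0< (λ y≡0F → σ≢0F 1≤n (𝐮 m) (trans (sym (𝐮-pos+1 m)) y≡0F)))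
    to (q , refl , refl , _) | no x≢0F | yes y≡0F = inj₂ (inj₁ (cong toℕ y≡0F , nonzero⇒0< x≢0F))
    to (q , refl , refl , _) | no x≢0F | no y≢0F with adjacent-nonzero q x≢0F y≢0F
    ... | m , refl , t = inj₂ (inj₂ (trans (𝐮-pos+1 m) (σ≡top t) , trans (𝐮-pos+2 m) (τ≡top t)))
    from : ⟦ fan 0 1≤n ⟧ ⊆ Ext []
    from {x , y} (inj₁ (x≡0 , 0<y)) with σ-preimage y 0<y
    ... | b , _ , refl with letter-occurs b
    ...   | m , refl = subst (λ x → Ext [] (x , σ (𝐮 m))) (toℕ-injective {j = x} (sym x≡0)) (Ext-at-block false m refl)
    from {x , y} (inj₂ (inj₁ (y≡0 , 0<x))) with σ-preimage x 0<x
    ... | b , _ , refl with letter-occurs b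
    ...   | m , refl = subst (λ y → Ext [] (σ (𝐮 m) , y)) (toℕ-injective {j = y} (sym y≡0)) (Ext-before-block false m refl)
    from (inj₂ (inj₂ (refl , refl))) with letter-occurs top
    ... | m , 𝐮m≡top with Flank⇒occurs-before-block true m (Flank-𝐮 true m 𝐮m≡top (Flank-top true))
    ...   | q , _ , o = q , o

  0F≢top : 0F ≢ top
  0F≢top 0F≡top = top≢0F 1≤n (sym 0F≡top)

  Ext-top : Ext (top ∷ []) ≐ ⟦ corner 0F 0F top top 0F≢top 0F≢top ⟧
  Ext-top = to , from
    where
    to : Ext (top ∷ []) ⊆ ⟦ corner 0F 0F top top 0F≢top 0F≢top ⟧
    to (q , refl , e-top , refl , _) with position (suc q)
    ... | first m e = contradiction (trans (sym e-top) (trans (cong 𝐮 e) (𝐮-pos m))) (top≢0F 1≤n)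
    ... | second m refl with below-or-top (𝐮 m)
    ...   | inj₁ lt = inj₁ (𝐮-pos m , trans (𝐮-pos+2 m) (τ-below lt))
    ...   | inj₂ t  = inj₂ (inj₁ (𝐮-pos m , trans (𝐮-pos+2 m) (τ≡top t)))
    to (q , refl , e-top , refl , _) | third m refl t =
      inj₂ (inj₂ (trans (𝐮-pos+1 m) (σ≡top t) , trans (cong 𝐮 (sym (pos-suc-top m t))) (𝐮-pos (suc m))))
    from : ⟦ corner 0F 0F top top 0F≢top 0F≢top ⟧ ⊆ Ext (top ∷ [])
    from (inj₁ (refl , refl)) with letter-occurs penultimate
    ... | m , 𝐮m≡a = Ext-at-block true m (Flank-𝐮 true m 𝐮m≡a (Flank-true-penultimate 1+penultimate≡n))
    from (inj₂ (inj₁ (refl , refl))) with letter-occurs top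
    ... | m , 𝐮m≡top = Ext-at-block true m (Flank-𝐮 true m 𝐮m≡top (Flank-top true))
    from (inj₂ (inj₂ (refl , refl))) with letter-occurs top
    ... | m , 𝐮m≡top = Ext-before-block true m (Flank-𝐮 true m 𝐮m≡top (Flank-top true))

  Ext-imageWord≐ : (bl br : Bool) (v : List A) {c : Family}
    → Ext v ≐ ⟦ c ⟧ → Ext (imageWord bl br v) ≐ FlankImage bl br ⟦ c ⟧
  Ext-imageWord≐ bl br v Ext-v≐ = ≐-trans (Ext-imageWord⁻ bl br v , Ext-imageWord⁺ bl br v) (FlankImage-cong bl br Ext-v≐)

  classify : (bound : ℕ) (w : List A) → length w < bound → Bispecial (Ext w) → InFamily (Ext w)
  classify (suc bound) w |w|<bound B with bispecialForm w B
  ... | empty     = fan 0 1≤n , Ext-ε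
  ... | singleTop = corner 0F 0F top top 0F≢top 0F≢top , Ext-top
  ... | image bl br v with classify bound v (≤-trans (length-<-imageWord bl br v) (s≤s⁻¹ |w|<bound))
                                 (Bispecial-preimage bl br (Bispecial-mono (Ext-imageWord⁻ bl br v) B))
  ...   | c , Ext-v≐ with family-image c bl br (Bispecial-mono (proj₁ (Ext-imageWord≐ bl br v Ext-v≐)) B)
  ...     | c′ , image≐ = c′ , ≐-trans (Ext-imageWord≐ bl br v Ext-v≐) image≐

  bispecial-ordinary : (w : List A) → Bispecial (Ext w) → Ordinary (Ext w)
  bispecial-ordinary w B with classify (suc (length w)) w ≤-refl B
  ... | c , Ext≐ = Ordinary-resp (≐-sym Ext≐) (family-ordinary c)

  InLext⇔ : (w : List A) (x : A) → InLext n w x ⇔ (∃[ y ] Ext w (x , y))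
  InLext⇔ w x = mk⇔ to (λ (_ , q , o) → occurs⇒factor q (x ∷ w) (occurs-++⁻ˡ q (x ∷ w) _ o))
    where
    to : InLext n w x → ∃[ y ] Ext w (x , y)
    to xw with factor⇒occurs (x ∷ w) xw
    ... | q , o = 𝐮 (q + length (x ∷ w)) , q , occurs-++⁺ q (x ∷ w) _ o (refl , tt)

  InRext⇔ : (w : List A) (y : A) → InRext n w y ⇔ (∃[ x ] Ext w (x , y))
  InRext⇔ w y = mk⇔ to (λ (_ , q , _ , o) → occurs⇒factor (suc q) (w ++ y ∷ []) o)
    where
    to : InRext n w y → ∃[ x ] Ext w (x , y)
    to wy with factor⇒occurs (w ++ y ∷ []) wy
    ... | suc q , o = 𝐮 q , q , refl , o
    ... | zero  , o with occurs-later _ o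
    ...   | q , o′ = 𝐮 q , q , refl , o′

  InBext⇔ : (w : List A) (p : A × A) → InBext n w p ⇔ Ext w p
  InBext⇔ w (x , y) = mk⇔ (factor⇒occurs (x ∷ w ++ y ∷ [])) (λ (q , o) → occurs⇒factor q (x ∷ w ++ y ∷ []) o)

  LeftSpecial-enumerated : (w : List A) {L : List A} → Enumerates (InLext n w) L → 2 ≤ length L → LeftSpecial (Ext w)
  LeftSpecial-enumerated w (unique , ∈⇔) 2≤|L| with two-distinct 2≤|L| unique
  ... | a , b , a∈ , b∈ , a≢b = a , proj₁ (ext a∈) , b , proj₁ (ext b∈) , proj₂ (ext a∈) , proj₂ (ext b∈) , a≢b
    where
    ext : {x : A} → x ∈ _ → ∃[ y ] Ext w (x , y)
    ext {x} x∈ = Equivalence.to (InLext⇔ w x) (Equivalence.to (∈⇔ x) x∈)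

  RightSpecial-enumerated : (w : List A) {R : List A} → Enumerates (InRext n w) R → 2 ≤ length R → RightSpecial (Ext w)
  RightSpecial-enumerated w (unique , ∈⇔) 2≤|R| with two-distinct 2≤|R| unique
  ... | a , b , a∈ , b∈ , a≢b = proj₁ (ext a∈) , a , proj₁ (ext b∈) , b , proj₂ (ext a∈) , proj₂ (ext b∈) , a≢b
    where
    ext : {y : A} → y ∈ _ → ∃[ x ] Ext w (x , y)
    ext {y} y∈ = Equivalence.to (InRext⇔ w y) (Equivalence.to (∈⇔ y) y∈)

open import Data.Integer using (+_)

theorem12 : (n : ℕ) → 3 ≤ suc n → (w : List (Fin (suc n)))
    → (L : List (Fin (suc n))) → Enumerates (InLext n w) L
    → (R : List (Fin (suc n))) → Enumerates (InRext n w) R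
    → (B : List (Fin (suc n) × Fin (suc n))) → Enumerates (InBext n w) B
    → 2 ≤ length L → 2 ≤ length R
    → bilateralOrder (length B) (length L) (length R) ≡ + 0
theorem12 n (s≤s (s≤s _)) w L L-enum R R-enum B B-enum 2≤|L| 2≤|R| =
  bilateralOrder-ordinary (length B) (length L) (length R) (begin
    length B + 1                    ≡⟨ cong (_+ 1) (Enumerates-length (InBext⇔ w) B-enum pairs-enum) ⟩
    length pairs + 1                ≡⟨ count ⟩
    length lefts + length rights    ≡⟨ cong₂ _+_ (Enumerates-length (InLext⇔ w) L-enum lefts-enum)
                                                 (Enumerates-length (InRext⇔ w) R-enum rights-enum) ⟨
    length L + length R             ∎)
  where
  1≤n : 1 ≤ n
  1≤n = s≤s z≤n
  open Families n 1≤n using (module Ordinary)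
  open Classification n 1≤n
  open Ordinary (bispecial-ordinary w (LeftSpecial-enumerated w L-enum 2≤|L| , RightSpecial-enumerated w R-enum 2≤|R|))
  open ≡-Reasoning
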